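{- Let $m>0$ and $v=(j,\tau,T)\in\mathcal{W}(S_{2m+1})$. Then the Möbius function of the poset $(\mathcal{W}(S_{2m+1}),\leqslant)$ satisfies $\mu(e,v)=(-1)^{|T|}$ if $\tau=e$ and $j=m+1$, and $\mu(e,v)=0$ otherwise. In particular, if $v=(\tau,T)\in\mathcal{W}(S_{2m})$ then $\mu(e,v)=(-1)^{|T|}$ if $\tau=e$ and $\mu(e,v)=0$ otherwise (Möbius function of $(\mathcal{W}(S_{2m}),\leqslant)$).
   Context: $S_n$ is the symmetric group on $[n]$ in one-line notation, $\leqslant$ Bruhat order, $e$ the identity. For $i\in[n]$ let $i^*=i-1$ if $i$ even, $i^*=i+1$ if $i$ odd and $i+1\le n$, $i^*=n$ otherwise; $\mathcal{W}(S_n)=\{\sigma\in S_n:|\sigma^{ -1}(i)-\sigma^{ -1}(i^*)|\le1\ \forall i\in[n-1]\}$ with the induced Bruhat order. For $u\in S_m$, $T\subseteq[m]$, the permutation $v$ with $v(2i-1)=2u(i)-1$, $v(2i)=2u(i)$ if $i\notin T$ and $v(2i-1)=2u(i)$, $v(2i)=2u(i)-1$ if $i\in T$ defines a bijection $S_m\times\mathcal{P}([m])\to\mathcal{W}(S_{2m})$; write $v=(u,T)$. For $v\in\mathcal{W}(S_{2m+1})$ let $\mathrm{pos}(v)=v^{ -1}(2m+1)$, delete $2m+1$ from $v$ to get $(\tau,T)\in\mathcal{W}(S_{2m})$, and write $v=(j,\tau,T)$ with $j=(\mathrm{pos}(v)+1)/2\in[m+1]$. -}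

module Defs where

open import Data.Nat using (ℕ; zero; suc; _+_; _*_; _∸_; _≡ᵇ_; _≤ᵇ_; _<ᵇ_; ⌊_/2⌋; ∣_-_∣)
open import Data.Bool using (Bool; true; false; _∧_; not; if_then_else_)
open import Data.List using (List; []; _∷_; map; concatMap; upTo; length; filterᵇ; take)
open import Data.Bool.ListAction using (all; any)
open import Data.Integer using (ℤ; -_) renaming (_^_ to _^ℤ_)
import Data.Integer as ℤ

-- Permutations of [n] in one-line notation, as lists of naturals
-- with values in {1,…,n}.

range : ℕ → List ℕ
range n = map suc (upTo n)

words : ℕ → ℕ → List (List ℕ)
words n zero    = [] ∷ []
words n (suc k) = concatMap (λ a → map (a ∷_) (words n k)) (range n)

isPerm : ℕ → List ℕ → Bool
isPerm n w = (length w ≡ᵇ n)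
           ∧ all (λ a → (1 ≤ᵇ a) ∧ (a ≤ᵇ n)) w
           ∧ all (λ a → any (λ b → a ≡ᵇ b) w) (range n)

idPerm : ℕ → List ℕ
idPerm n = range n

-- w(i), 1-based (junk value 0 out of range)
at : List ℕ → ℕ → ℕ
at []       _             = 0
at (x ∷ xs) zero          = 0
at (x ∷ xs) (suc zero)    = x
at (x ∷ xs) (suc (suc i)) = at xs (suc i)

-- w⁻¹(a), 1-based (junk value 0 if a does not occur)
posOf : List ℕ → ℕ → ℕ
posOf []       a = 0
posOf (x ∷ xs) a = if x ≡ᵇ a then 1 else (if posOf xs a ≡ᵇ 0 then 0 else suc (posOf xs a))

-- Bruhat order on S_n (tableau / rank criterion, Björner–Brenti 2.1.5):
-- σ ≤ π  iff  σ[i,k] ≤ π[i,k] for all i,k ∈ [n],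
-- where σ[i,k] = #{ a ≤ i : σ(a) ≥ k }.

rankCount : List ℕ → ℕ → ℕ → ℕ
rankCount σ i k = length (filterᵇ (λ x → k ≤ᵇ x) (take i σ))

bruhat : ℕ → List ℕ → List ℕ → Bool
bruhat n σ π = all (λ i → all (λ k → rankCount σ i k ≤ᵇ rankCount π i k) (range n)) (range n)

even : ℕ → Bool
even zero          = true
even (suc zero)    = false
even (suc (suc n)) = even n

star : ℕ → ℕ → ℕ
star n i = if even i then i ∸ 1 else (if (i + 1) ≤ᵇ n then i + 1 else n)

isW : ℕ → List ℕ → Bool
isW n v = isPerm n v
        ∧ all (λ i → ∣ posOf v i - posOf v (star n i) ∣ ≤ᵇ 1) (range (n ∸ 1))

-- the elements of W(S_n), listed without repetition
Wlist : ℕ → List (List ℕ)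
Wlist n = filterᵇ (isW n) (words n n)

-- Möbius function of a finite poset (P, ≤) given by a duplicate-free
-- list of its elements, a boolean order and a boolean equality:
-- μ(x,x) = 1, μ(x,y) = - Σ_{x ≤ z < y} μ(x,z) if x < y, μ(x,y) = 0 otherwise.
-- The recursion is driven by fuel; fuel = |P| suffices because every
-- strict chain in P has at most |P| elements.

eqList : List ℕ → List ℕ → Bool
eqList []       []       = true
eqList (x ∷ xs) (y ∷ ys) = (x ≡ᵇ y) ∧ eqList xs ys
eqList _        _        = false

module _ {A : Set} (P : List A) (_≤?_ : A → A → Bool) (_=?_ : A → A → Bool) where

  mobiusFuel : ℕ → A → A → ℤ
  mobiusFuel zero    x y = ℤ.0ℤ
  mobiusFuel (suc f) x y =
    if x =? y then ℤ.1ℤ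
    else (if x ≤? y
          then - ℤsum (map (mobiusFuel f x) (filterᵇ (λ z → (x ≤? z) ∧ (z ≤? y) ∧ not (z =? y)) P))
          else ℤ.0ℤ)
    where
      ℤsum : List ℤ → ℤ
      ℤsum []       = ℤ.0ℤ
      ℤsum (a ∷ as) = a ℤ.+ ℤsum as

  mobius : A → A → ℤ
  mobius = mobiusFuel (length P)

μW : ℕ → List ℕ → List ℕ → ℤ
μW n = mobius (Wlist n) (bruhat n) eqList

-- Decomposition v = (u,T) for v ∈ W(S_{2m}):
-- u(i) = ⌈v(2i-1)/2⌉ and i ∈ T iff v(2i-1) = 2u(i) (i.e. v(2i-1) is even).

decU : ℕ → List ℕ → List ℕ
decU m v = map (λ i → ⌊ at v (2 * i ∸ 1) + 1 /2⌋) (range m)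

decT : ℕ → List ℕ → List ℕ
decT m v = filterᵇ (λ i → even (at v (2 * i ∸ 1))) (range m)

-- Decomposition v = (j,τ,T) for v ∈ W(S_{2m+1}):
-- pos(v) = v⁻¹(2m+1), delete 2m+1 to get (τ,T), j = (pos(v)+1)/2.

deleteMax : ℕ → List ℕ → List ℕ
deleteMax m v = filterᵇ (λ a → not (a ≡ᵇ (2 * m + 1))) v

decJ : ℕ → List ℕ → ℕ
decJ m v = ⌊ posOf v (2 * m + 1) + 1 /2⌋

decτ : ℕ → List ℕ → List ℕ
decτ m v = decU m (deleteMax m v)

decTodd : ℕ → List ℕ → List ℕ
decTodd m v = decT m (deleteMax m v)

signPow : ℕ → ℤ
signPow k = (- ℤ.1ℤ) ^ℤ k

-- Write e for the identity. The only elements with a nonzero claimed value are the block permutations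
-- (e, S) (followed by 2m+1 in the odd case): e with the pairs 2i-1, 2i for i ∈ S swapped. Their rank
-- counts exceed those of e by one exactly at the swapped pairs, so (e, S) ≤ y iff e ≤ y and S ⊆ A(y), where
-- A(y) lists the pairs at which y has such an excess. For e < y the Möbius recursion therefore sums
-- (-1)^|S| over the S ⊆ A(y) with (e, S) ≠ y, which gives [A(y) = ∅] minus (-1)^|T| if y = (e, T), in which
-- case A(y) = T. Finally A(y) = ∅ and e ≤ y force y = e: reading y pair by pair, the rank conditions put 2i-1
-- at position 2i-1 and the adjacency condition of W puts 2i right after it. So the claimed values satisfy
-- the recursion that defines μ(e, ·), and agree with it by induction on the height in the poset.

module Submission where

open import Defs
open import Data.Bool using (Bool; true; false; _∧_; not; if_then_else_; T)
open import Data.Bool.ListAction using (all; any)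
open import Data.Bool.Properties using (T-≡; ∧-conicalˡ; ∧-conicalʳ; ∧-zeroʳ; ∧-identityʳ; not-injective)
import Data.Bool.Properties as Bool
open import Data.Empty using (⊥-elim)
open import Data.Integer using (ℤ; 0ℤ; 1ℤ) renaming (_+_ to _+ℤ_; _-_ to _-ℤ_; -_ to -ℤ_)
import Data.Integer.Properties as ℤₚ
import Algebra.Properties.CommutativeSemigroup as CommutativeSemigroupProperties
open CommutativeSemigroupProperties ℤₚ.+-commutativeSemigroup using (interchange)
open import Data.List using (List; []; _∷_; map; concatMap; applyUpTo; replicate; length; filterᵇ; _++_)
open import Data.List.Properties
  using (≡-dec; length-replicate; ∷-injective; ++-assoc; ++-identityʳ; length-++; length-filter; filter-some; filter-++; filter-all; filter-reject)
open import Data.List.Membership.Propositional using (_∈_; _∉_)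
open import Data.List.Membership.Propositional.Properties
  using (∈-++⁻; ∈-++⁺ˡ; ∈-++⁺ʳ; ∈-map⁺; ∈-map⁻; ∈-concat⁺′; ∈-filter⁺; ∈-filter⁻)
import Data.List.Relation.Unary.All as All
open import Data.List.Relation.Unary.All.Properties using (all⁺; all⁻)
open import Data.List.Relation.Unary.Any as Any using (here; there)
open import Data.List.Relation.Unary.Any.Properties using (any⁺; any⁻)
open import Data.Nat
open import Data.Nat.Properties
open CommutativeSemigroupProperties +-commutativeSemigroup using () renaming (x∙yz≈y∙xz to +-exchange)
open import Data.Product using (_×_; _,_; proj₁; proj₂; ∃; ∃₂)
open import Data.Sum using (_⊎_; inj₁; inj₂)
open import Function using (Equivalence; _∘_; id)
open import Relation.Binary.Definitions using (DecidableEquality)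
open import Relation.Binary.PropositionalEquality
open import Relation.Nullary using (¬_; yes; no; does; T?)

private
  variable
    A B : Set

≡true⇒T : ∀ {b} → b ≡ true → T b
≡true⇒T = Equivalence.from T-≡

T⇒≡true : ∀ {b} → T b → b ≡ true
T⇒≡true = Equivalence.to T-≡

≡true-ext : ∀ {a b : Bool} → (a ≡ true → b ≡ true) → (b ≡ true → a ≡ true) → a ≡ b
≡true-ext {true}  {true}  _ _ = refl
≡true-ext {true}  {false} f _ = sym (f refl)
≡true-ext {false} {true}  _ g = g refl
≡true-ext {false} {false} _ _ = refl

≡ᵇ-refl : ∀ n → (n ≡ᵇ n) ≡ true
≡ᵇ-refl n = T⇒≡true (≡⇒≡ᵇ n n refl)

≡ᵇ-true⇒≡ : ∀ {m n} → (m ≡ᵇ n) ≡ true → m ≡ n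
≡ᵇ-true⇒≡ {m} {n} h = ≡ᵇ⇒≡ m n (≡true⇒T h)

≢⇒≡ᵇ-false : ∀ {m n} → m ≢ n → (m ≡ᵇ n) ≡ false
≢⇒≡ᵇ-false {m} {n} m≢n with m ≡ᵇ n in eq
... | true  = ⊥-elim (m≢n (≡ᵇ-true⇒≡ eq))
... | false = refl

≡ᵇ-false⇒≢ : ∀ {m n} → (m ≡ᵇ n) ≡ false → m ≢ n
≡ᵇ-false⇒≢ {m} h refl with () ← trans (sym (≡ᵇ-refl m)) h

eqList-refl : ∀ xs → eqList xs xs ≡ true
eqList-refl []       = refl
eqList-refl (x ∷ xs) rewrite ≡ᵇ-refl x = eqList-refl xs

eqList-false⇒≢ : ∀ {xs ys} → eqList xs ys ≡ false → xs ≢ ys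
eqList-false⇒≢ {xs} xs≠ys refl with () ← trans (sym (eqList-refl xs)) xs≠ys

eqList-true⇒≡ : ∀ {xs ys} → eqList xs ys ≡ true → xs ≡ ys
eqList-true⇒≡ {[]}     {[]}     _  = refl
eqList-true⇒≡ {x ∷ xs} {y ∷ ys} eq = cong₂ _∷_ (≡ᵇ-true⇒≡ (∧-conicalˡ _ _ eq)) (eqList-true⇒≡ (∧-conicalʳ (x ≡ᵇ y) _ eq))

≤ᵇ-true⇒≤ : ∀ {m n} → (m ≤ᵇ n) ≡ true → m ≤ n
≤ᵇ-true⇒≤ {m} {n} h = ≤ᵇ⇒≤ m n (≡true⇒T h)

≤⇒≤ᵇ-true : ∀ {m n} → m ≤ n → (m ≤ᵇ n) ≡ true
≤⇒≤ᵇ-true m≤n = T⇒≡true (≤⇒≤ᵇ m≤n)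

≤ᵇ-false⇒> : ∀ {m n} → (m ≤ᵇ n) ≡ false → n < m
≤ᵇ-false⇒> {m} {n} h with m ≤? n
... | yes m≤n with () ← trans (sym (≤⇒≤ᵇ-true m≤n)) h
... | no  m≰n = ≰⇒> m≰n

>⇒≤ᵇ-false : ∀ {m n} → n < m → (m ≤ᵇ n) ≡ false
>⇒≤ᵇ-false {m} {n} n<m with m ≤ᵇ n in eq
... | true  = ⊥-elim (<⇒≱ n<m (≤ᵇ-true⇒≤ eq))
... | false = refl

all-true⇒ : ∀ (p : A → Bool) {xs} → all p xs ≡ true → ∀ {x} → x ∈ xs → p x ≡ true
all-true⇒ p h x∈xs = T⇒≡true (All.lookup (all⁺ p _ (≡true⇒T h)) x∈xs)

⇒all-true : ∀ (p : A → Bool) {xs} → (∀ {x} → x ∈ xs → p x ≡ true) → all p xs ≡ true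
⇒all-true p h = T⇒≡true (all⁻ p (All.tabulate (≡true⇒T ∘ h)))

∈-filterᵇ⁻ : ∀ {p : A → Bool} {L z} → z ∈ filterᵇ p L → z ∈ L × p z ≡ true
∈-filterᵇ⁻ {p = p} z∈ with z∈L , pz ← ∈-filter⁻ (T? ∘ p) z∈ = z∈L , T⇒≡true pz

any-≡ᵇ⇒∈ : ∀ a xs → any (a ≡ᵇ_) xs ≡ true → a ∈ xs
any-≡ᵇ⇒∈ a xs h = Any.map (λ {x} → ≡ᵇ⇒≡ a x) (any⁻ (a ≡ᵇ_) xs (≡true⇒T h))

∈⇒any-≡ᵇ : ∀ {a xs} → a ∈ xs → any (a ≡ᵇ_) xs ≡ true
∈⇒any-≡ᵇ {a} a∈xs = T⇒≡true (any⁺ (a ≡ᵇ_) (Any.map (λ { refl → ≡⇒≡ᵇ a a refl }) a∈xs))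

rangeFrom : ℕ → ℕ → List ℕ
rangeFrom c zero    = []
rangeFrom c (suc k) = suc c ∷ rangeFrom (suc c) k

range≡rangeFrom : ∀ n → range n ≡ rangeFrom 0 n
range≡rangeFrom n = go id 0 n (λ _ → refl)
  where
  go : ∀ f c k → (∀ i → f i ≡ c + i) → map suc (applyUpTo f k) ≡ rangeFrom c k
  go f c zero    f≗c+ = refl
  go f c (suc k) f≗c+ = cong₂ _∷_ (cong suc (trans (f≗c+ 0) (+-identityʳ c)))
                                  (go (f ∘ suc) (suc c) k (λ i → trans (f≗c+ (suc i)) (+-suc c i)))

rangeFrom-++ : ∀ c a b → rangeFrom c (a + b) ≡ rangeFrom c a ++ rangeFrom (c + a) b
rangeFrom-++ c zero    b = cong (λ x → rangeFrom x b) (sym (+-identityʳ c))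
rangeFrom-++ c (suc a) b = cong (suc c ∷_) (trans (rangeFrom-++ (suc c) a b)
                                                  (cong (λ x → rangeFrom (suc c) a ++ rangeFrom x b) (sym (+-suc c a))))

∈-rangeFrom⁺ : ∀ {c k i} → c < i → i ≤ c + k → i ∈ rangeFrom c k
∈-rangeFrom⁺ {c} {zero}  c<i i≤c+0 = ⊥-elim (<⇒≱ c<i (subst (_ ≤_) (+-identityʳ c) i≤c+0))
∈-rangeFrom⁺ {c} {suc k} {i} c<i i≤c+k with i ≟ suc c
... | yes refl = here refl
... | no  i≢  = there (∈-rangeFrom⁺ (≤∧≢⇒< c<i (i≢ ∘ sym)) (subst (i ≤_) (+-suc c k) i≤c+k))

∈-rangeFrom⁻ : ∀ {c k i} → i ∈ rangeFrom c k → c < i × i ≤ c + k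
∈-rangeFrom⁻ {c} {suc k} (here refl) = ≤-refl , subst (suc c ≤_) (sym (+-suc c k)) (s≤s (m≤m+n c k))
∈-rangeFrom⁻ {c} {suc k} {i} (there i∈) with ∈-rangeFrom⁻ i∈
... | c<i , i≤c+k = <-trans (n<1+n c) c<i , subst (i ≤_) (sym (+-suc c k)) i≤c+k

∈-range⁺ : ∀ {n a} → 1 ≤ a → a ≤ n → a ∈ range n
∈-range⁺ {n} 1≤a a≤n = subst (_ ∈_) (sym (range≡rangeFrom n)) (∈-rangeFrom⁺ 1≤a a≤n)

∈-range⁻ : ∀ {n a} → a ∈ range n → 1 ≤ a × a ≤ n
∈-range⁻ {n} a∈ = ∈-rangeFrom⁻ (subst (_ ∈_) (range≡rangeFrom n) a∈)

all-range-true⇒ : ∀ (p : ℕ → Bool) n → all p (range n) ≡ true → ∀ {i} → 1 ≤ i → i ≤ n → p i ≡ true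
all-range-true⇒ p n h 1≤i i≤n = all-true⇒ p h (∈-range⁺ 1≤i i≤n)

⇒all-range-true : ∀ (p : ℕ → Bool) n → (∀ {i} → 1 ≤ i → i ≤ n → p i ≡ true) → all p (range n) ≡ true
⇒all-range-true p n h = ⇒all-true p (λ i∈ → let (1≤i , i≤n) = ∈-range⁻ i∈ in h 1≤i i≤n)

sumOver : List A → (A → ℤ) → ℤ
sumOver []      g = 0ℤ
sumOver (x ∷ L) g = g x +ℤ sumOver L g

ind : Bool → ℤ → ℤ
ind b c = if b then c else 0ℤ

ind-0 : ∀ b → ind b 0ℤ ≡ 0ℤ
ind-0 true  = refl
ind-0 false = refl

ind-∧ : ∀ a b c → ind (a ∧ b) c ≡ ind a (ind b c)
ind-∧ true  b c = refl
ind-∧ false b c = refl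

ind-∧-not : ∀ a b c → ind (a ∧ not b) c ≡ ind a c -ℤ ind (a ∧ b) c
ind-∧-not true  true  c = sym (ℤₚ.+-inverseʳ c)
ind-∧-not true  false c = sym (ℤₚ.+-identityʳ c)
ind-∧-not false b     c = refl

sumOver-cong : (L : List A) {g h : A → ℤ} → (∀ {z} → z ∈ L → g z ≡ h z) → sumOver L g ≡ sumOver L h
sumOver-cong []      g≗h = refl
sumOver-cong (x ∷ L) g≗h = cong₂ _+ℤ_ (g≗h (here refl)) (sumOver-cong L (g≗h ∘ there))

sumOver-zero : (L : List A) {g : A → ℤ} → (∀ {z} → z ∈ L → g z ≡ 0ℤ) → sumOver L g ≡ 0ℤ
sumOver-zero L g≗0 = trans (sumOver-cong L g≗0) (go L)
  where
  go : (L : List A) → sumOver L (λ _ → 0ℤ) ≡ 0ℤ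
  go []      = refl
  go (x ∷ L) = trans (ℤₚ.+-identityˡ _) (go L)

sumOver-filter : (p : A → Bool) (L : List A) (g : A → ℤ) →
                 sumOver (filterᵇ p L) g ≡ sumOver L (λ z → ind (p z) (g z))
sumOver-filter p []      g = refl
sumOver-filter p (x ∷ L) g with p x
... | true  = cong (g x +ℤ_) (sumOver-filter p L g)
... | false = trans (sumOver-filter p L g) (sym (ℤₚ.+-identityˡ _))

sumOver-++ : (L M : List A) (g : A → ℤ) → sumOver (L ++ M) g ≡ sumOver L g +ℤ sumOver M g
sumOver-++ []      M g = sym (ℤₚ.+-identityˡ _)
sumOver-++ (x ∷ L) M g = trans (cong (g x +ℤ_) (sumOver-++ L M g)) (sym (ℤₚ.+-assoc (g x) _ _))

sumOver-map : (f : A → B) (L : List A) (g : B → ℤ) → sumOver (map f L) g ≡ sumOver L (g ∘ f)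
sumOver-map f []      g = refl
sumOver-map f (x ∷ L) g = cong (g (f x) +ℤ_) (sumOver-map f L g)

sumOver-concatMap : (f : A → List B) (L : List A) (g : B → ℤ) →
                    sumOver (concatMap f L) g ≡ sumOver L (λ x → sumOver (f x) g)
sumOver-concatMap f []      g = refl
sumOver-concatMap f (x ∷ L) g =
  trans (sumOver-++ (f x) (concatMap f L) g) (cong (sumOver (f x) g +ℤ_) (sumOver-concatMap f L g))

sumOver-+ : (L : List A) (g h : A → ℤ) → sumOver L (λ z → g z +ℤ h z) ≡ sumOver L g +ℤ sumOver L h
sumOver-+ []      g h = refl
sumOver-+ (x ∷ L) g h =
  trans (cong (g x +ℤ h x +ℤ_) (sumOver-+ L g h)) (interchange (g x) (h x) (sumOver L g) (sumOver L h))

sumOver-neg : (L : List A) (g : A → ℤ) → sumOver L (λ z → -ℤ g z) ≡ -ℤ sumOver L g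
sumOver-neg []      g = refl
sumOver-neg (x ∷ L) g = trans (cong (-ℤ g x +ℤ_) (sumOver-neg L g)) (sym (ℤₚ.neg-distrib-+ (g x) _))

sumOver-ind : (L : List A) (b : Bool) (h : A → ℤ) → sumOver L (λ z → ind b (h z)) ≡ ind b (sumOver L h)
sumOver-ind L true  h = refl
sumOver-ind L false h = sumOver-zero L (λ _ → refl)

sumOver-comm : (L : List A) (M : List B) (f : A → B → ℤ) →
               sumOver L (λ x → sumOver M (f x)) ≡ sumOver M (λ y → sumOver L (λ x → f x y))
sumOver-comm []      M f = sym (sumOver-zero M (λ _ → refl))
sumOver-comm (x ∷ L) M f =
  trans (cong (sumOver M (f x) +ℤ_) (sumOver-comm L M f)) (sym (sumOver-+ M (f x) (λ y → sumOver L (λ x′ → f x′ y))))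

module _ (_==_ : B → B → Bool) (==-sound : ∀ {x y} → x == y ≡ true → x ≡ y)
         (L : List B) (Q : List A) (f : A → B) where

  -- Both sides equal the double sum of [f S = z] G (f S) over z ∈ L and S ∈ Q.
  sumOver-reindex : (∀ {S} → S ∈ Q → ∀ v → sumOver L (λ z → ind (f S == z) v) ≡ v) →
                    (∀ {T} → T ∈ Q → ∀ v → sumOver Q (λ S → ind (f S == f T) v) ≡ v) →
                    (G : B → ℤ) → (∀ z → G z ≢ 0ℤ → ∃ λ T → T ∈ Q × z ≡ f T) →
                    sumOver L G ≡ sumOver Q (G ∘ f)
  sumOver-reindex once-in-L once-in-image G support = begin
    sumOver L G
      ≡⟨ sumOver-cong L (λ {z} _ → sym (expand z)) ⟩
    sumOver L (λ z → sumOver Q (λ S → ind (f S == z) (G (f S))))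
      ≡⟨ sumOver-comm L Q _ ⟩
    sumOver Q (λ S → sumOver L (λ z → ind (f S == z) (G (f S))))
      ≡⟨ sumOver-cong Q (λ S∈ → once-in-L S∈ _) ⟩
    sumOver Q (G ∘ f) ∎
    where
    open ≡-Reasoning
    transport : ∀ S z → ind (f S == z) (G (f S)) ≡ ind (f S == z) (G z)
    transport S z with f S == z in eq
    ... | true  = cong G (==-sound eq)
    ... | false = refl
    expand : ∀ z → sumOver Q (λ S → ind (f S == z) (G (f S))) ≡ G z
    expand z with G z ℤₚ.≟ 0ℤ
    ... | yes Gz≡0 = trans (sumOver-zero Q (λ {S} _ → trans (transport S z) (trans (cong (ind _) Gz≡0) (ind-0 _))))
                           (sym Gz≡0)
    ... | no  Gz≢0 with support z Gz≢0
    ...   | T , T∈ , refl = trans (sumOver-cong Q (λ {S} _ → transport S (f T))) (once-in-image T∈ (G (f T)))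

sumOver-rangeFrom-indicator : ∀ c N a v → c < a → a ≤ c + N →
                              sumOver (rangeFrom c N) (λ x → ind (a ≡ᵇ x) v) ≡ v
sumOver-rangeFrom-indicator c zero    a v c<a a≤c+0 = ⊥-elim (<⇒≱ c<a (subst (a ≤_) (+-identityʳ c) a≤c+0))
sumOver-rangeFrom-indicator c (suc N) a v c<a a≤c+N with a ≟ suc c
... | yes refl rewrite ≡ᵇ-refl c = trans (cong (v +ℤ_) (sumOver-zero (rangeFrom (suc c) N) miss)) (ℤₚ.+-identityʳ v)
  where
  miss : ∀ {x} → x ∈ rangeFrom (suc c) N → ind (suc c ≡ᵇ x) v ≡ 0ℤ
  miss x∈ rewrite ≢⇒≡ᵇ-false (<⇒≢ (proj₁ (∈-rangeFrom⁻ x∈))) = refl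
... | no  a≢ rewrite ≢⇒≡ᵇ-false a≢ =
  trans (ℤₚ.+-identityˡ _) (sumOver-rangeFrom-indicator (suc c) N a v (≤∧≢⇒< c<a (a≢ ∘ sym)) (subst (a ≤_) (+-suc c N) a≤c+N))

sumOver-words-indicator : ∀ n k w v → length w ≡ k → (∀ {x} → x ∈ w → 1 ≤ x × x ≤ n) →
                          sumOver (words n k) (λ z → ind (eqList w z) v) ≡ v
sumOver-words-indicator n zero    []      v refl w⊆[1,n] = ℤₚ.+-identityʳ v
sumOver-words-indicator n (suc k) (a ∷ w) v refl w⊆[1,n] = begin
  sumOver (words n (suc k)) (λ z → ind (eqList (a ∷ w) z) v)
    ≡⟨ sumOver-concatMap (λ x → map (x ∷_) (words n k)) (range n) _ ⟩
  sumOver (range n) (λ x → sumOver (map (x ∷_) (words n k)) (λ z → ind (eqList (a ∷ w) z) v))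
    ≡⟨ sumOver-cong (range n) (λ {x} _ → first-letter x) ⟩
  sumOver (range n) (λ x → ind (a ≡ᵇ x) v)
    ≡⟨ cong (λ L → sumOver L (λ x → ind (a ≡ᵇ x) v)) (range≡rangeFrom n) ⟩
  sumOver (rangeFrom 0 n) (λ x → ind (a ≡ᵇ x) v)
    ≡⟨ sumOver-rangeFrom-indicator 0 n a v (proj₁ (w⊆[1,n] (here refl))) (proj₂ (w⊆[1,n] (here refl))) ⟩
  v ∎
  where
  open ≡-Reasoning
  first-letter : ∀ x → sumOver (map (x ∷_) (words n k)) (λ z → ind (eqList (a ∷ w) z) v) ≡ ind (a ≡ᵇ x) v
  first-letter x = begin
    sumOver (map (x ∷_) (words n k)) (λ z → ind (eqList (a ∷ w) z) v)
      ≡⟨ sumOver-map (x ∷_) (words n k) _ ⟩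
    sumOver (words n k) (λ z → ind ((a ≡ᵇ x) ∧ eqList w z) v)
      ≡⟨ sumOver-cong (words n k) (λ {z} _ → ind-∧ (a ≡ᵇ x) (eqList w z) v) ⟩
    sumOver (words n k) (λ z → ind (a ≡ᵇ x) (ind (eqList w z) v))
      ≡⟨ sumOver-ind (words n k) (a ≡ᵇ x) _ ⟩
    ind (a ≡ᵇ x) (sumOver (words n k) (λ z → ind (eqList w z) v))
      ≡⟨ cong (ind (a ≡ᵇ x)) (sumOver-words-indicator n k w v refl (w⊆[1,n] ∘ there)) ⟩
    ind (a ≡ᵇ x) v ∎

∈-words : ∀ n k w → length w ≡ k → (∀ {x} → x ∈ w → 1 ≤ x × x ≤ n) → w ∈ words n k
∈-words n zero    []      refl _       = here refl
∈-words n (suc k) (a ∷ w) refl w⊆[1,n] =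
  ∈-concat⁺′ (∈-map⁺ (a ∷_) (∈-words n k w refl (w⊆[1,n] ∘ there)))
             (∈-map⁺ (λ x → map (x ∷_) (words n k)) (∈-range⁺ (proj₁ (w⊆[1,n] (here refl))) (proj₂ (w⊆[1,n] (here refl)))))

subsets : ℕ → List (List Bool)
subsets zero    = [] ∷ []
subsets (suc m) = map (true ∷_) (subsets m) ++ map (false ∷_) (subsets m)

∈-subsets⇒length : ∀ {m S} → S ∈ subsets m → length S ≡ m
∈-subsets⇒length {zero}  (here refl) = refl
∈-subsets⇒length {suc m} {S} S∈ with ∈-++⁻ (map (true ∷_) (subsets m)) S∈
... | inj₁ S∈ₜ with _ , S′∈ , refl ← ∈-map⁻ (true ∷_) S∈ₜ = cong suc (∈-subsets⇒length S′∈)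
... | inj₂ S∈f with _ , S′∈ , refl ← ∈-map⁻ (false ∷_) S∈f = cong suc (∈-subsets⇒length S′∈)

∈-subsets⁺ : ∀ {S m} → length S ≡ m → S ∈ subsets m
∈-subsets⁺ {[]}        refl = here refl
∈-subsets⁺ {true ∷ S}  refl = ∈-++⁺ˡ (∈-map⁺ (true ∷_) (∈-subsets⁺ refl))
∈-subsets⁺ {false ∷ S} refl = ∈-++⁺ʳ (map (true ∷_) (subsets (length S))) (∈-map⁺ (false ∷_) (∈-subsets⁺ refl))

sumOver-subsets-suc : ∀ m (g : List Bool → ℤ) →
  sumOver (subsets (suc m)) g ≡ sumOver (subsets m) (g ∘ (true ∷_)) +ℤ sumOver (subsets m) (g ∘ (false ∷_))
sumOver-subsets-suc m g =
  trans (sumOver-++ (map (true ∷_) (subsets m)) _ g)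
        (cong₂ _+ℤ_ (sumOver-map (true ∷_) (subsets m) g) (sumOver-map (false ∷_) (subsets m) g))

_≟ᴮ_ : DecidableEquality (List Bool)
_≟ᴮ_ = ≡-dec Bool._≟_

sumOver-subsets-indicator : ∀ T v → sumOver (subsets (length T)) (λ S → ind (does (S ≟ᴮ T)) v) ≡ v
sumOver-subsets-indicator []          v = ℤₚ.+-identityʳ v
sumOver-subsets-indicator (true ∷ T)  v =
  trans (sumOver-subsets-suc (length T) _)
        (trans (cong₂ _+ℤ_ (sumOver-subsets-indicator T v) (sumOver-zero (subsets (length T)) (λ _ → refl)))
               (ℤₚ.+-identityʳ v))
sumOver-subsets-indicator (false ∷ T) v =
  trans (sumOver-subsets-suc (length T) _)
        (trans (cong₂ _+ℤ_ (sumOver-zero (subsets (length T)) (λ _ → refl)) (sumOver-subsets-indicator T v))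
               (ℤₚ.+-identityˡ v))

_⊆ᵇ_ : List Bool → List Bool → Bool
[]      ⊆ᵇ _       = true
(_ ∷ _) ⊆ᵇ []      = false
(s ∷ S) ⊆ᵇ (u ∷ U) = (if s then u else true) ∧ (S ⊆ᵇ U)

⊆ᵇ-refl : ∀ T → T ⊆ᵇ T ≡ true
⊆ᵇ-refl []          = refl
⊆ᵇ-refl (true ∷ T)  = ⊆ᵇ-refl T
⊆ᵇ-refl (false ∷ T) = ⊆ᵇ-refl T

countTrue : List Bool → ℕ
countTrue []          = 0
countTrue (true ∷ S)  = suc (countTrue S)
countTrue (false ∷ S) = countTrue S

sign : List Bool → ℤ
sign S = signPow (countTrue S)

signPow-suc : ∀ k → signPow (suc k) ≡ -ℤ signPow k
signPow-suc k = ℤₚ.-1*i≡-i (signPow k)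

signPow≢0 : ∀ k → signPow k ≢ 0ℤ
signPow≢0 zero    ()
signPow≢0 (suc k) eq = signPow≢0 k (trans (sym (ℤₚ.neg-involutive _)) (cong -ℤ_ (trans (sym (signPow-suc k)) eq)))

-- An entry true of U splits the sum into two cancelling halves, so only U = false…false survives.
sumOver-subsets-sign : ∀ U → sumOver (subsets (length U)) (λ S → ind (S ⊆ᵇ U) (sign S)) ≡ ind (all not U) 1ℤ
sumOver-subsets-sign []      = refl
sumOver-subsets-sign (a ∷ U) = trans (sumOver-subsets-suc (length U) _) (split a)
  where
  rest = sumOver (subsets (length U)) (λ S → ind (S ⊆ᵇ U) (sign S))
  negate : ∀ b k → ind b (signPow (suc k)) ≡ -ℤ ind b (signPow k)
  negate true  k = signPow-suc k
  negate false k = refl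
  split : ∀ a → sumOver (subsets (length U)) (λ S → ind (a ∧ S ⊆ᵇ U) (sign (true ∷ S))) +ℤ rest
              ≡ ind (not a ∧ all not U) 1ℤ
  split false = trans (cong (_+ℤ rest) (sumOver-zero (subsets (length U)) (λ _ → refl)))
                      (trans (ℤₚ.+-identityˡ rest) (sumOver-subsets-sign U))
  split true  = trans (cong (_+ℤ rest) (trans (sumOver-cong (subsets (length U)) (λ {S} _ → negate (S ⊆ᵇ U) (countTrue S)))
                                              (sumOver-neg (subsets (length U)) _)))
                      (ℤₚ.+-inverseˡ rest)

sumOver-proper-subsets-sign : ∀ T →
  sumOver (subsets (length T)) (λ S → ind (S ⊆ᵇ T ∧ not (does (S ≟ᴮ T))) (sign S)) ≡ ind (all not T) 1ℤ -ℤ sign T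
sumOver-proper-subsets-sign T = begin
  sumOver Sub (λ S → ind (S ⊆ᵇ T ∧ not (does (S ≟ᴮ T))) (sign S))
    ≡⟨ sumOver-cong Sub (λ {S} _ → ind-∧-not (S ⊆ᵇ T) (does (S ≟ᴮ T)) (sign S)) ⟩
  sumOver Sub (λ S → ind (S ⊆ᵇ T) (sign S) -ℤ ind (S ⊆ᵇ T ∧ does (S ≟ᴮ T)) (sign S))
    ≡⟨ sumOver-+ Sub _ _ ⟩
  sumOver Sub (λ S → ind (S ⊆ᵇ T) (sign S)) +ℤ sumOver Sub (λ S → -ℤ ind (S ⊆ᵇ T ∧ does (S ≟ᴮ T)) (sign S))
    ≡⟨ cong₂ _+ℤ_ (sumOver-subsets-sign T) (sumOver-neg Sub _) ⟩
  ind (all not T) 1ℤ -ℤ sumOver Sub (λ S → ind (S ⊆ᵇ T ∧ does (S ≟ᴮ T)) (sign S))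
    ≡⟨ cong (λ s → ind (all not T) 1ℤ -ℤ s) (trans (sumOver-cong Sub (λ {S} _ → only-T S)) (sumOver-subsets-indicator T (sign T))) ⟩
  ind (all not T) 1ℤ -ℤ sign T ∎
  where
  open ≡-Reasoning
  Sub = subsets (length T)
  only-T : ∀ S → ind (S ⊆ᵇ T ∧ does (S ≟ᴮ T)) (sign S) ≡ ind (does (S ≟ᴮ T)) (sign T)
  only-T S with S ≟ᴮ T
  ... | yes refl rewrite ⊆ᵇ-refl S = refl
  ... | no  _    = cong (λ b → ind b (sign S)) (∧-zeroʳ (S ⊆ᵇ T))

-- The Möbius function of a finite poset

module _ (p q : A → Bool) (p⇒q : ∀ {u} → p u ≡ true → q u ≡ true) where

  length-filterᵇ-mono : ∀ L → length (filterᵇ p L) ≤ length (filterᵇ q L)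
  length-filterᵇ-mono []      = z≤n
  length-filterᵇ-mono (x ∷ L) with p x in px | q x in qx
  ... | true  | true  = s≤s (length-filterᵇ-mono L)
  ... | true  | false with () ← trans (sym (p⇒q px)) qx
  ... | false | true  = m≤n⇒m≤1+n (length-filterᵇ-mono L)
  ... | false | false = length-filterᵇ-mono L

  length-filterᵇ-strict : ∀ {L u} → u ∈ L → q u ≡ true → p u ≡ false → length (filterᵇ p L) < length (filterᵇ q L)
  length-filterᵇ-strict {x ∷ L} (here refl) qu pu rewrite qu | pu = s≤s (length-filterᵇ-mono L)
  length-filterᵇ-strict {x ∷ L} (there u∈) qu pu with p x in px | q x in qx
  ... | true  | true  = s≤s (length-filterᵇ-strict u∈ qu pu)
  ... | true  | false with () ← trans (sym (p⇒q px)) qx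
  ... | false | true  = m≤n⇒m≤1+n (length-filterᵇ-strict u∈ qu pu)
  ... | false | false = length-filterᵇ-strict u∈ qu pu

module _ (P : List A) (_≤?_ _=?_ : A → A → Bool) where

  interval : A → A → List A
  interval x y = filterᵇ (λ z → (x ≤? z) ∧ (z ≤? y) ∧ not (z =? y)) P

  private
    μ = mobiusFuel P _≤?_ _=?_

    sum-unique : (s : List ℤ → ℤ) → s [] ≡ 0ℤ → (∀ a as → s (a ∷ as) ≡ a +ℤ s as) → ∀ L → s L ≡ sumOver L id
    sum-unique s s[] s∷ []      = s[]
    sum-unique s s[] s∷ (a ∷ L) = trans (s∷ a L) (cong (a +ℤ_) (sum-unique s s[] s∷ L))

  mobiusFuel-diag : ∀ f {x y} → x =? y ≡ true → μ (suc f) x y ≡ 1ℤ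
  mobiusFuel-diag f x=y rewrite x=y = refl

  mobiusFuel-≰ : ∀ f {x y} → x =? y ≡ false → x ≤? y ≡ false → μ (suc f) x y ≡ 0ℤ
  mobiusFuel-≰ f x≠y x≰y rewrite x≠y | x≰y = refl

  mobiusFuel-< : ∀ f {x y} → x =? y ≡ false → x ≤? y ≡ true → μ (suc f) x y ≡ -ℤ sumOver (interval x y) (μ f x)
  mobiusFuel-< f {x} {y} x≠y x≤y = trans unfold (cong -ℤ_ (sumOver-map (μ f x) (interval x y) id))
    where
    -- The sum in mobiusFuel is a local function of Defs, so it is identified through its two defining equations.
    unfold : μ (suc f) x y ≡ -ℤ sumOver (map (μ f x) (interval x y)) id
    unfold with x =? y | x ≤? y
    ... | false | true with map (μ f x) (interval x y) | sum-unique _ refl (λ _ _ → refl)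
    ...   | terms | defining-sum≡ = cong -ℤ_ (defining-sum≡ terms)

  module _ (≤?-refl : ∀ y → y ≤? y ≡ true)
           (≤?-trans : ∀ {u z y} → u ≤? z ≡ true → z ≤? y ≡ true → u ≤? y ≡ true)
           (≤?-antisym : ∀ {z y} → z ∈ P → y ∈ P → z ≤? y ≡ true → y ≤? z ≡ true → z ≡ y)
           (=?-refl : ∀ y → y =? y ≡ true)
           (x : A) (Φ : A → ℤ)
           (Φ-diag : ∀ {y} → x =? y ≡ true → Φ y ≡ 1ℤ)
           (Φ-≰ : ∀ {y} → y ∈ P → x =? y ≡ false → x ≤? y ≡ false → Φ y ≡ 0ℤ)
           (Φ-< : ∀ {y} → y ∈ P → x =? y ≡ false → x ≤? y ≡ true → sumOver (interval x y) Φ ≡ -ℤ Φ y)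
           where

    private
      height : A → ℕ
      height y = length (filterᵇ (_≤? y) P)

      height-< : ∀ {z y} → z ∈ P → y ∈ P → z ≤? y ≡ true → z =? y ≡ false → height z < height y
      height-< {z} {y} z∈ y∈ z≤y z≠y = length-filterᵇ-strict (_≤? z) (_≤? y) (λ u≤z → ≤?-trans u≤z z≤y) y∈ (≤?-refl y) y≰z
        where
        y≰z : y ≤? z ≡ false
        y≰z with y ≤? z in y≤z
        ... | false = refl
        ... | true with refl ← ≤?-antisym z∈ y∈ z≤y y≤z with () ← trans (sym (=?-refl z)) z≠y

      height-pos : ∀ {y} → y ∈ P → 0 < height y
      height-pos {y} y∈ = filter-some (T? ∘ (_≤? y)) (Any.map (λ { refl → ≡true⇒T (≤?-refl y) }) y∈)

      mobiusFuel≡Φ : ∀ f {y} → y ∈ P → height y ≤ f → μ f x y ≡ Φ y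
      mobiusFuel≡Φ zero    y∈ hy≤0 = ⊥-elim (<⇒≱ (height-pos y∈) hy≤0)
      mobiusFuel≡Φ (suc f) {y} y∈ hy≤f+1 = by-cases (x =? y) refl (x ≤? y) refl
        where
        open ≡-Reasoning
        induction : ∀ {z} → z ∈ interval x y → μ f x z ≡ Φ z
        induction z∈ with z∈P , x≤z∧z<y ← ∈-filterᵇ⁻ z∈ =
          mobiusFuel≡Φ f z∈P (≤-pred (≤-trans (height-< z∈P y∈ z≤y z≠y) hy≤f+1))
          where
          z≤y = ∧-conicalˡ _ _ (∧-conicalʳ (x ≤? _) _ x≤z∧z<y)
          z≠y = not-injective (∧-conicalʳ _ _ (∧-conicalʳ (x ≤? _) _ x≤z∧z<y))
        by-cases : ∀ b → x =? y ≡ b → ∀ c → x ≤? y ≡ c → μ (suc f) x y ≡ Φ y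
        by-cases true  x=y _     _   = trans (mobiusFuel-diag f x=y) (sym (Φ-diag x=y))
        by-cases false x≠y false x≰y = trans (mobiusFuel-≰ f x≠y x≰y) (sym (Φ-≰ y∈ x≠y x≰y))
        by-cases false x≠y true  x≤y = begin
          μ (suc f) x y                     ≡⟨ mobiusFuel-< f x≠y x≤y ⟩
          -ℤ sumOver (interval x y) (μ f x) ≡⟨ cong -ℤ_ (sumOver-cong (interval x y) induction) ⟩
          -ℤ sumOver (interval x y) Φ       ≡⟨ cong -ℤ_ (Φ-< y∈ x≠y x≤y) ⟩
          -ℤ (-ℤ Φ y)                       ≡⟨ ℤₚ.neg-involutive (Φ y) ⟩
          Φ y                               ∎

    mobius≡ : ∀ {y} → y ∈ P → mobius P _≤?_ _=?_ x y ≡ Φ y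
    mobius≡ y∈ = mobiusFuel≡Φ (length P) y∈ (length-filter (T? ∘ (_≤? _)) P)

-- W(S_n) and the Bruhat order

record InW (n : ℕ) (y : List ℕ) : Set where
  field
    length≡  : length y ≡ n
    bounded  : ∀ {x} → x ∈ y → 1 ≤ x × x ≤ n
    complete : ∀ {a} → 1 ≤ a → a ≤ n → a ∈ y
    adjacent : ∀ {i} → 1 ≤ i → i ≤ n ∸ 1 → ∣ posOf y i - posOf y (star n i) ∣ ≤ 1

isW⇒InW : ∀ {n y} → isW n y ≡ true → InW n y
isW⇒InW {n} {y} y∈W = record
  { length≡  = ≡ᵇ-true⇒≡ length≡n
  ; bounded  = λ {x} x∈ → let 1≤x∧x≤n = all-true⇒ _ bounded x∈
                          in ≤ᵇ-true⇒≤ (∧-conicalˡ _ _ 1≤x∧x≤n) , ≤ᵇ-true⇒≤ (∧-conicalʳ (1 ≤ᵇ x) _ 1≤x∧x≤n)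
  ; complete = λ 1≤a a≤n → any-≡ᵇ⇒∈ _ y (all-range-true⇒ _ n complete 1≤a a≤n)
  ; adjacent = λ 1≤i i≤n-1 → ≤ᵇ-true⇒≤ (all-range-true⇒ _ (n ∸ 1) adjacent 1≤i i≤n-1)
  }
  where
  perm     = ∧-conicalˡ _ _ y∈W
  adjacent = ∧-conicalʳ (isPerm n y) _ y∈W
  length≡n = ∧-conicalˡ _ _ perm
  bounded  = ∧-conicalˡ _ _ (∧-conicalʳ (length y ≡ᵇ n) _ perm)
  complete = ∧-conicalʳ (all _ y) _ (∧-conicalʳ (length y ≡ᵇ n) _ perm)

InW⇒isW : ∀ {n y} → InW n y → isW n y ≡ true
InW⇒isW {n} {y} y∈W = cong₂ _∧_ (cong₂ _∧_ length≡n (cong₂ _∧_ bounded complete)) adjacent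
  where
  open InW y∈W renaming (length≡ to len; bounded to bnd; complete to cpl; adjacent to adj)
  length≡n = subst (λ l → (l ≡ᵇ n) ≡ true) (sym len) (≡ᵇ-refl n)
  bounded  = ⇒all-true _ (λ x∈ → cong₂ _∧_ (≤⇒≤ᵇ-true (proj₁ (bnd x∈))) (≤⇒≤ᵇ-true (proj₂ (bnd x∈))))
  complete = ⇒all-range-true _ n (λ 1≤a a≤n → ∈⇒any-≡ᵇ (cpl 1≤a a≤n))
  adjacent = ⇒all-range-true _ (n ∸ 1) (λ 1≤i i≤n-1 → ≤⇒≤ᵇ-true (adj 1≤i i≤n-1))

bit : Bool → ℕ
bit true  = 1
bit false = 0

rankCount-[] : ∀ i k → rankCount [] i k ≡ 0
rankCount-[] zero    k = refl
rankCount-[] (suc i) k = refl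

rankCount-∷ : ∀ a σ i k → rankCount (a ∷ σ) (suc i) k ≡ bit (k ≤ᵇ a) + rankCount σ i k
rankCount-∷ a σ i k with k ≤ᵇ a
... | true  = refl
... | false = refl

rankCount-++ : ∀ P R i k → rankCount (P ++ R) (length P + i) k ≡ rankCount P (length P) k + rankCount R i k
rankCount-++ []      R i k = refl
rankCount-++ (p ∷ P) R i k = begin
  rankCount (p ∷ P ++ R) (suc (length P + i)) k          ≡⟨ rankCount-∷ p (P ++ R) (length P + i) k ⟩
  bit (k ≤ᵇ p) + rankCount (P ++ R) (length P + i) k     ≡⟨ cong (bit (k ≤ᵇ p) +_) (rankCount-++ P R i k) ⟩
  bit (k ≤ᵇ p) + (rankCount P (length P) k + rankCount R i k) ≡⟨ +-assoc (bit (k ≤ᵇ p)) _ _ ⟨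
  bit (k ≤ᵇ p) + rankCount P (length P) k + rankCount R i k   ≡⟨ cong (_+ rankCount R i k) (rankCount-∷ p P (length P) k) ⟨
  rankCount (p ∷ P) (suc (length P)) k + rankCount R i k ∎
  where open ≡-Reasoning

rankCount-below : ∀ P i k → (∀ {x} → x ∈ P → x < k) → rankCount P i k ≡ 0
rankCount-below []      i       k P<k = rankCount-[] i k
rankCount-below (p ∷ P) zero    k P<k = refl
rankCount-below (p ∷ P) (suc i) k P<k rewrite rankCount-∷ p P i k | >⇒≤ᵇ-false (P<k (here refl)) =
  rankCount-below P i k (P<k ∘ there)

module _ (n : ℕ) (σ π : List ℕ) where

  bruhat⇒ : bruhat n σ π ≡ true → ∀ {i k} → 1 ≤ i → i ≤ n → 1 ≤ k → k ≤ n → rankCount σ i k ≤ rankCount π i k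
  bruhat⇒ σ≤π 1≤i i≤n 1≤k k≤n = ≤ᵇ-true⇒≤ (all-range-true⇒ _ n (all-range-true⇒ _ n σ≤π 1≤i i≤n) 1≤k k≤n)

  ⇒bruhat : (∀ {i k} → 1 ≤ i → i ≤ n → 1 ≤ k → k ≤ n → rankCount σ i k ≤ rankCount π i k) → bruhat n σ π ≡ true
  ⇒bruhat σ≤π = ⇒all-range-true _ n (λ 1≤i i≤n → ⇒all-range-true _ n (λ 1≤k k≤n → ≤⇒≤ᵇ-true (σ≤π 1≤i i≤n 1≤k k≤n)))

bruhat-refl : ∀ n σ → bruhat n σ σ ≡ true
bruhat-refl n σ = ⇒bruhat n σ σ (λ _ _ _ _ → ≤-refl)

bruhat-trans : ∀ n {σ τ π} → bruhat n σ τ ≡ true → bruhat n τ π ≡ true → bruhat n σ π ≡ true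
bruhat-trans n {σ} {τ} {π} σ≤τ τ≤π =
  ⇒bruhat n σ π (λ 1≤i i≤n 1≤k k≤n → ≤-trans (bruhat⇒ n σ τ σ≤τ 1≤i i≤n 1≤k k≤n) (bruhat⇒ n τ π τ≤π 1≤i i≤n 1≤k k≤n))

-- The rank counts at i = 1 determine the first entry.
rankCount-injective : ∀ N (y z : List ℕ) → length y ≡ length z →
  (∀ {x} → x ∈ y → 1 ≤ x × x ≤ N) → (∀ {x} → x ∈ z → 1 ≤ x × x ≤ N) →
  (∀ {i k} → 1 ≤ i → i ≤ length y → 1 ≤ k → k ≤ N → rankCount y i k ≡ rankCount z i k) → y ≡ z
rankCount-injective N []      []      _     _  _  _       = refl
rankCount-injective N (a ∷ y) (b ∷ z) |y|≡|z| y⊆N z⊆N same =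
  cong₂ _∷_ a≡b (rankCount-injective N y z (suc-injective |y|≡|z|) (y⊆N ∘ there) (z⊆N ∘ there) same-tail)
  where
  first : ∀ {k} → 1 ≤ k → k ≤ N → bit (k ≤ᵇ a) ≡ bit (k ≤ᵇ b)
  first {k} 1≤k k≤N =
    +-cancelʳ-≡ 0 _ _ (trans (sym (rankCount-∷ a y 0 k)) (trans (same (s≤s z≤n) (s≤s z≤n) 1≤k k≤N) (rankCount-∷ b z 0 k)))
  bit≡1⇒≤ : ∀ {k c} → bit (k ≤ᵇ c) ≡ 1 → k ≤ c
  bit≡1⇒≤ {k} {c} h with k ≤ᵇ c in k≤c
  ... | true = ≤ᵇ-true⇒≤ k≤c
  bit-refl : ∀ c → bit (c ≤ᵇ c) ≡ 1
  bit-refl c rewrite ≤⇒≤ᵇ-true (≤-refl {c}) = refl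
  a≡b : a ≡ b
  a≡b = ≤-antisym (bit≡1⇒≤ (trans (sym (first (proj₁ (y⊆N (here refl))) (proj₂ (y⊆N (here refl))))) (bit-refl a)))
                  (bit≡1⇒≤ (trans (first (proj₁ (z⊆N (here refl))) (proj₂ (z⊆N (here refl)))) (bit-refl b)))
  same-tail : ∀ {i k} → 1 ≤ i → i ≤ length y → 1 ≤ k → k ≤ N → rankCount y i k ≡ rankCount z i k
  same-tail {i} {k} 1≤i i≤|y| 1≤k k≤N = +-cancelˡ-≡ (bit (k ≤ᵇ a)) _ _
    (trans (sym (rankCount-∷ a y i k)) (trans (same (s≤s z≤n) (s≤s i≤|y|) 1≤k k≤N)
           (trans (rankCount-∷ b z i k) (cong (λ c → bit (k ≤ᵇ c) + rankCount z i k) (sym a≡b)))))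

bruhat-antisym : ∀ n {σ π} → InW n σ → InW n π → bruhat n σ π ≡ true → bruhat n π σ ≡ true → σ ≡ π
bruhat-antisym n {σ} {π} σ∈W π∈W σ≤π π≤σ =
  rankCount-injective n σ π (trans (InW.length≡ σ∈W) (sym (InW.length≡ π∈W))) (InW.bounded σ∈W) (InW.bounded π∈W)
    (λ 1≤i i≤|σ| 1≤k k≤n → let i≤n = subst (_ ≤_) (InW.length≡ σ∈W) i≤|σ| in
       ≤-antisym (bruhat⇒ n σ π σ≤π 1≤i i≤n 1≤k k≤n) (bruhat⇒ n π σ π≤σ 1≤i i≤n 1≤k k≤n))

-- Block permutations and their rank counts

block : Bool → ℕ → List ℕ → List ℕ
block false d r = suc d ∷ suc (suc d) ∷ r
block true  d r = suc (suc d) ∷ suc d ∷ r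

-- blocks S d tl lists d+1, …, d+2|S| in consecutive pairs, the j-th pair swapped iff S_j, followed by tl.
-- Thus blocks S 0 [] is (e, S) ∈ W(S_2m) and blocks S 0 (2m+1 ∷ []) is (m+1, e, S) ∈ W(S_2m+1).
blocks : List Bool → ℕ → List ℕ → List ℕ
blocks []      d tl = tl
blocks (b ∷ S) d tl = block b d (blocks S (suc (suc d)) tl)

unswapped : ℕ → List Bool
unswapped m = replicate m false

countTrue-unswapped : ∀ m → countTrue (unswapped m) ≡ 0
countTrue-unswapped zero    = refl
countTrue-unswapped (suc m) = countTrue-unswapped m

blocks-unswapped : ∀ m d tl → blocks (unswapped m) d tl ≡ rangeFrom d (2 * m) ++ tl
blocks-unswapped zero    d tl = refl
blocks-unswapped (suc m) d tl rewrite +-suc m (m + 0) = cong (λ L → suc d ∷ suc (suc d) ∷ L) (blocks-unswapped m (suc (suc d)) tl)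

identity-even : ∀ m → idPerm (2 * m) ≡ blocks (unswapped m) 0 []
identity-even m = trans (range≡rangeFrom (2 * m)) (sym (trans (blocks-unswapped m 0 []) (++-identityʳ _)))

identity-odd : ∀ m → idPerm (2 * m + 1) ≡ blocks (unswapped m) 0 (2 * m + 1 ∷ [])
identity-odd m = trans (range≡rangeFrom (2 * m + 1))
  (trans (rangeFrom-++ 0 (2 * m) 1)
         (sym (trans (blocks-unswapped m 0 _) (cong (λ x → rangeFrom 0 (2 * m) ++ x ∷ []) (+-comm (2 * m) 1)))))

length-block : ∀ b d r → length (block b d r) ≡ 2 + length r
length-block false d r = refl
length-block true  d r = refl

length-blocks : ∀ S d tl → length (blocks S d tl) ≡ 2 * length S + length tl
length-blocks []      d tl = refl
length-blocks (b ∷ S) d tl = begin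
  length (block b d (blocks S (suc (suc d)) tl)) ≡⟨ length-block b d _ ⟩
  2 + length (blocks S (suc (suc d)) tl)         ≡⟨ cong (2 +_) (length-blocks S (suc (suc d)) tl) ⟩
  2 + (2 * length S + length tl)                 ≡⟨ +-assoc 2 (2 * length S) (length tl) ⟨
  2 + 2 * length S + length tl                   ≡⟨ cong (_+ length tl) (*-suc 2 (length S)) ⟨
  2 * length (b ∷ S) + length tl                 ∎
  where open ≡-Reasoning

length-blocks-[] : ∀ S d → length (blocks S d []) ≡ 2 * length S
length-blocks-[] S d = trans (length-blocks S d []) (+-identityʳ _)

blocks-++ : ∀ S d tl → blocks S d [] ++ tl ≡ blocks S d tl
blocks-++ []          d tl = refl
blocks-++ (false ∷ S) d tl = cong (λ L → suc d ∷ suc (suc d) ∷ L) (blocks-++ S (suc (suc d)) tl)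
blocks-++ (true ∷ S)  d tl = cong (λ L → suc (suc d) ∷ suc d ∷ L) (blocks-++ S (suc (suc d)) tl)

≤ᵇ-suc : ∀ a b → (suc a ≤ᵇ suc b) ≡ (a ≤ᵇ b)
≤ᵇ-suc zero    b = refl
≤ᵇ-suc (suc a) b = refl

bit-≤ᵇ-suc : ∀ k n → bit (k ≤ᵇ suc n) ≡ bit (k ≤ᵇ n) + bit (k ≡ᵇ suc n)
bit-≤ᵇ-suc zero          n       = refl
bit-≤ᵇ-suc (suc zero)    zero    = refl
bit-≤ᵇ-suc (suc (suc k)) zero    = refl
bit-≤ᵇ-suc (suc k)       (suc n) rewrite ≤ᵇ-suc k (suc n) | ≤ᵇ-suc k n = bit-≤ᵇ-suc k n

rankCount-swap : ∀ P d r i k →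
  rankCount (P ++ block true d r) i k ≡ rankCount (P ++ block false d r) i k + bit ((i ≡ᵇ suc (length P)) ∧ (k ≡ᵇ suc (suc d)))
rankCount-swap []      d r zero          k = refl
rankCount-swap []      d r (suc zero)    k
  rewrite rankCount-∷ (suc (suc d)) (suc d ∷ r) 0 k | rankCount-∷ (suc d) (suc (suc d) ∷ r) 0 k
        | +-identityʳ (bit (k ≤ᵇ suc (suc d))) | +-identityʳ (bit (k ≤ᵇ suc d)) = bit-≤ᵇ-suc k (suc d)
rankCount-swap []      d r (suc (suc i)) k
  rewrite rankCount-∷ (suc (suc d)) (suc d ∷ r) (suc i) k | rankCount-∷ (suc d) (suc (suc d) ∷ r) (suc i) k
        | rankCount-∷ (suc d) r i k | rankCount-∷ (suc (suc d)) r i k =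
  trans (+-exchange (bit (k ≤ᵇ suc (suc d))) (bit (k ≤ᵇ suc d)) (rankCount r i k)) (sym (+-identityʳ _))
rankCount-swap (p ∷ P) d r zero          k = refl
rankCount-swap (p ∷ P) d r (suc i)       k
  rewrite rankCount-∷ p (P ++ block true d r) i k | rankCount-∷ p (P ++ block false d r) i k | rankCount-swap P d r i k =
  sym (+-assoc (bit (k ≤ᵇ p)) _ _)

excess : List Bool → ℕ → ℕ → ℕ → ℕ
excess []      d i k = 0
excess (b ∷ S) d i k = bit (b ∧ (i ≡ᵇ suc d) ∧ (k ≡ᵇ suc (suc d))) + excess S (suc (suc d)) i k

rankCount-block : ∀ b P r i k →
  rankCount (P ++ block b (length P) r) i k
    ≡ rankCount (P ++ block false (length P) r) i k + bit (b ∧ (i ≡ᵇ suc (length P)) ∧ (k ≡ᵇ suc (suc (length P))))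
rankCount-block false P r i k = sym (+-identityʳ _)
rankCount-block true  P r i k = rankCount-swap P (length P) r i k

rankCount-blocks-after : ∀ S P {d} tl i k → length P ≡ d →
  rankCount (P ++ blocks S d tl) i k ≡ rankCount (P ++ blocks (unswapped (length S)) d tl) i k + excess S d i k
rankCount-blocks-after []      P tl i k _    = sym (+-identityʳ _)
rankCount-blocks-after (b ∷ S) P tl i k refl = begin
  rankCount (P ++ block b d R) i k                   ≡⟨ rankCount-block b P R i k ⟩
  rankCount (P ++ block false d R) i k + bₖ          ≡⟨ cong (λ L → rankCount L i k + bₖ) (sym (++-assoc P pair R)) ⟩
  rankCount ((P ++ pair) ++ R) i k + bₖ             ≡⟨ cong (_+ bₖ) (rankCount-blocks-after S (P ++ pair) tl i k |P++pair|) ⟩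
  rankCount ((P ++ pair) ++ R₀) i k + e + bₖ        ≡⟨ cong (λ L → rankCount L i k + e + bₖ) (++-assoc P pair R₀) ⟩
  rankCount (P ++ block false d R₀) i k + e + bₖ    ≡⟨ +-assoc (rankCount (P ++ block false d R₀) i k) e bₖ ⟩
  rankCount (P ++ block false d R₀) i k + (e + bₖ)  ≡⟨ cong (rankCount (P ++ block false d R₀) i k +_) (+-comm e bₖ) ⟩
  rankCount (P ++ block false d R₀) i k + (bₖ + e)  ∎
  where
  open ≡-Reasoning
  d    = length P
  pair = suc d ∷ suc (suc d) ∷ []
  R    = blocks S (suc (suc d)) tl
  R₀   = blocks (unswapped (length S)) (suc (suc d)) tl
  bₖ   = bit (b ∧ (i ≡ᵇ suc d) ∧ (k ≡ᵇ suc (suc d)))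
  e    = excess S (suc (suc d)) i k
  |P++pair| : length (P ++ pair) ≡ suc (suc d)
  |P++pair| = trans (length-++ P) (+-comm d 2)

rankCount-blocks : ∀ S tl i k → rankCount (blocks S 0 tl) i k ≡ rankCount (blocks (unswapped (length S)) 0 tl) i k + excess S 0 i k
rankCount-blocks S tl i k = rankCount-blocks-after S [] tl i k refl

rankCount-rangeFrom-above : ∀ c N tl i k → i ≤ N → c + i < k → rankCount (rangeFrom c N ++ tl) i k ≡ 0
rankCount-rangeFrom-above c N       tl zero    k _         _       = refl
rankCount-rangeFrom-above c (suc N) tl (suc i) k (s≤s i≤N) c+i+1<k
  rewrite rankCount-∷ (suc c) (rangeFrom (suc c) N ++ tl) i k
        | >⇒≤ᵇ-false {k} {suc c} (≤-<-trans (s≤s (m≤m+n c i)) (subst (_< k) (+-suc c i) c+i+1<k)) =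
  rankCount-rangeFrom-above (suc c) N tl i k i≤N (subst (_< k) (+-suc c i) c+i+1<k)

rankCount-rangeFrom-diag : ∀ c N tl i → i < N → rankCount (rangeFrom c N ++ tl) (suc i) (suc (c + i)) ≡ 1
rankCount-rangeFrom-diag c (suc N) tl zero    _
  rewrite rankCount-∷ (suc c) (rangeFrom (suc c) N ++ tl) 0 (suc (c + 0)) | +-identityʳ c | ≤ᵇ-suc c c
        | ≤⇒≤ᵇ-true (≤-refl {c}) = refl
rankCount-rangeFrom-diag c (suc N) tl (suc i) (s≤s i<N)
  rewrite rankCount-∷ (suc c) (rangeFrom (suc c) N ++ tl) (suc i) (suc (c + suc i)) | ≤ᵇ-suc (c + suc i) c
        | >⇒≤ᵇ-false {c + suc i} {c} (subst (c <_) (sym (+-suc c i)) (s≤s (m≤m+n c i)))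
        | +-suc c i = rankCount-rangeFrom-diag (suc c) N tl i i<N

excess-before : ∀ S d i k → i ≤ d → excess S d i k ≡ 0
excess-before []      d i k _   = refl
excess-before (b ∷ S) d i k i≤d rewrite ≢⇒≡ᵇ-false (<⇒≢ (s≤s i≤d)) | ∧-zeroʳ b =
  excess-before S (suc (suc d)) i k (≤-trans i≤d (≤-trans (n≤1+n d) (n≤1+n (suc d))))

+-suc≡⇒< : ∀ {j k m} → j + suc k ≡ m → j < m
+-suc≡⇒< {j} eq = subst (j <_) eq (m<m+n j (s≤s z≤n))

+-2*suc : ∀ d s → d + 2 * suc s ≡ suc (suc (d + 2 * s))
+-2*suc d s = trans (cong (d +_) (*-suc 2 s)) (trans (+-suc d _) (cong suc (+-suc d _)))

-- Entry j records whether y places a value ≥ d+2j+2 among its first d+2j+1 positions.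
swapPattern : List ℕ → ℕ → ℕ → List Bool
swapPattern y d zero    = []
swapPattern y d (suc j) = (1 ≤ᵇ rankCount y (suc d) (suc (suc d))) ∷ swapPattern y (suc (suc d)) j

length-swapPattern : ∀ y d j → length (swapPattern y d j) ≡ j
length-swapPattern y d zero    = refl
length-swapPattern y d (suc j) = cong suc (length-swapPattern y (suc (suc d)) j)

excess-⊆ : ∀ S d y → S ⊆ᵇ swapPattern y d (length S) ≡ true → ∀ i k →
  excess S d i k ≡ 0
  ⊎ ∃ λ d′ → d′ + 2 ≤ d + 2 * length S × i ≡ suc d′ × k ≡ suc (suc d′) × excess S d i k ≡ 1 × 1 ≤ rankCount y i k
excess-⊆ []      d y _   i k = inj₁ refl
excess-⊆ (b ∷ S) d y S⊆ i k with b ∧ (i ≡ᵇ suc d) ∧ (k ≡ᵇ suc (suc d)) in hit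
... | true  = inj₂ (d , +-monoʳ-≤ d (subst (2 ≤_) (sym (*-suc 2 (length S))) (m≤m+n 2 _)) , i≡ , k≡
                      , cong suc (excess-before S (suc (suc d)) i k (subst (_≤ suc (suc d)) (sym i≡) (n≤1+n (suc d))))
                      , rank≥1)
  where
  b≡true = ∧-conicalˡ _ _ hit
  i≡ = ≡ᵇ-true⇒≡ (∧-conicalˡ _ _ (∧-conicalʳ b _ hit))
  k≡ = ≡ᵇ-true⇒≡ (∧-conicalʳ (i ≡ᵇ suc d) _ (∧-conicalʳ b _ hit))
  head-⊆ : ∀ b {a rest} → (if b then a else true) ∧ rest ≡ true → b ≡ true → a ≡ true
  head-⊆ true h _ = ∧-conicalˡ _ _ h
  rank≥1 : 1 ≤ rankCount y i k
  rank≥1 = subst₂ (λ i k → 1 ≤ rankCount y i k) (sym i≡) (sym k≡) (≤ᵇ-true⇒≤ (head-⊆ b S⊆ b≡true))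
... | false with excess-⊆ S (suc (suc d)) y (∧-conicalʳ (if b then _ else true) _ S⊆) i k
...   | inj₁ e≡0 = inj₁ e≡0
...   | inj₂ (d′ , fits , i≡ , k≡ , e≡1 , rank≥1) =
  inj₂ (d′ , subst (d′ + 2 ≤_) (sym (+-2*suc d (length S))) fits , i≡ , k≡ , e≡1 , rank≥1)

excess-at-block : ∀ b S d → excess (b ∷ S) d (suc d) (suc (suc d)) ≡ bit b
excess-at-block b S d rewrite ≡ᵇ-refl d | excess-before S (suc (suc d)) (suc d) (suc (suc d)) (n≤1+n _) | ∧-identityʳ b =
  +-identityʳ (bit b)

⊆-swapPattern : ∀ S d y N → d + 2 * length S ≤ N →
  (∀ {i k} → 1 ≤ i → i ≤ N → 1 ≤ k → k ≤ N → excess S d i k ≤ rankCount y i k) → S ⊆ᵇ swapPattern y d (length S) ≡ true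
⊆-swapPattern []      d y N _     _        = refl
⊆-swapPattern (b ∷ S) d y N fits excess≤ =
  cong₂ _∧_ (head b (excess≤ (s≤s z≤n) (≤-trans (n≤1+n _) d+2≤N) (s≤s z≤n) d+2≤N))
            (⊆-swapPattern S (suc (suc d)) y N fits′ (λ 1≤i i≤N 1≤k k≤N → ≤-trans (m≤n+m _ _) (excess≤ 1≤i i≤N 1≤k k≤N)))
  where
  fits′ : suc (suc d) + 2 * length S ≤ N
  fits′ = subst (_≤ N) (+-2*suc d (length S)) fits
  d+2≤N : suc (suc d) ≤ N
  d+2≤N = ≤-trans (m≤m+n _ _) fits′
  head : ∀ b → excess (b ∷ S) d (suc d) (suc (suc d)) ≤ rankCount y (suc d) (suc (suc d)) →
         (if b then (1 ≤ᵇ rankCount y (suc d) (suc (suc d))) else true) ≡ true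
  head false _  = refl
  head true  e≤ = ≤⇒≤ᵇ-true (≤-trans (≤-reflexive (sym (excess-at-block true S d))) e≤)

swapPattern-from-excess : ∀ T d y →
  (∀ {d′} → d ≤ d′ → d′ + 2 ≤ d + 2 * length T → rankCount y (suc d′) (suc (suc d′)) ≡ excess T d (suc d′) (suc (suc d′))) →
  swapPattern y d (length T) ≡ T
swapPattern-from-excess []      d y _       = refl
swapPattern-from-excess (b ∷ T) d y rank≡ = cong₂ _∷_ head (swapPattern-from-excess T (suc (suc d)) y rank≡′)
  where
  1≤ᵇbit : ∀ b → (1 ≤ᵇ bit b) ≡ b
  1≤ᵇbit true  = refl
  1≤ᵇbit false = refl
  head : (1 ≤ᵇ rankCount y (suc d) (suc (suc d))) ≡ b
  head = trans (cong (1 ≤ᵇ_) (trans (rank≡ ≤-refl (+-monoʳ-≤ d (subst (2 ≤_) (sym (*-suc 2 (length T))) (m≤m+n 2 _))))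
                                    (excess-at-block b T d)))
               (1≤ᵇbit b)
  rank≡′ : ∀ {d′} → suc (suc d) ≤ d′ → d′ + 2 ≤ suc (suc d) + 2 * length T →
           rankCount y (suc d′) (suc (suc d′)) ≡ excess T (suc (suc d)) (suc d′) (suc (suc d′))
  rank≡′ {d′} d+2≤d′ fits
    rewrite rank≡ (≤-trans (n≤1+n d) (≤-trans (n≤1+n _) d+2≤d′)) (subst (d′ + 2 ≤_) (sym (+-2*suc d (length T))) fits)
    | ≢⇒≡ᵇ-false {suc d′} {suc d} (λ eq → <⇒≢ (≤-trans (n≤1+n _) d+2≤d′) (suc-injective (sym eq))) | ∧-zeroʳ b = refl

rankCount-unswapped-at-block : ∀ m tl d′ → d′ + 2 ≤ 2 * m → rankCount (blocks (unswapped m) 0 tl) (suc d′) (suc (suc d′)) ≡ 0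
rankCount-unswapped-at-block m tl d′ fits =
  trans (cong (λ L → rankCount L (suc d′) (suc (suc d′))) (blocks-unswapped m 0 tl))
        (rankCount-rangeFrom-above 0 (2 * m) tl (suc d′) (suc (suc d′)) (≤-trans (n≤1+n _) (subst (_≤ 2 * m) (+-comm d′ 2) fits)) ≤-refl)

swapPattern-blocks : ∀ T tl → swapPattern (blocks T 0 tl) 0 (length T) ≡ T
swapPattern-blocks T tl = swapPattern-from-excess T 0 (blocks T 0 tl) (λ {d′} _ fits →
  trans (rankCount-blocks T tl (suc d′) (suc (suc d′)))
        (cong (_+ excess T 0 (suc d′) (suc (suc d′))) (rankCount-unswapped-at-block (length T) tl d′ fits)))

bruhat-unswapped-blocks : ∀ n S tl → bruhat n (blocks (unswapped (length S)) 0 tl) (blocks S 0 tl) ≡ true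
bruhat-unswapped-blocks n S tl = ⇒bruhat n _ _ (λ {i} {k} _ _ _ _ →
  subst (rankCount (blocks (unswapped (length S)) 0 tl) i k ≤_) (sym (rankCount-blocks S tl i k)) (m≤m+n _ _))

bruhat-blocks : ∀ n S tl y → 2 * length S ≤ n →
  bruhat n (blocks S 0 tl) y ≡ bruhat n (blocks (unswapped (length S)) 0 tl) y ∧ S ⊆ᵇ swapPattern y 0 (length S)
bruhat-blocks n S tl y fits = ≡true-ext
  (λ S≤y → cong₂ _∧_ (⇒bruhat n _ y (λ 1≤i i≤n 1≤k k≤n → ≤-trans (m≤m+n _ _) (rank≤ S≤y 1≤i i≤n 1≤k k≤n)))
                     (⊆-swapPattern S 0 y n fits (λ 1≤i i≤n 1≤k k≤n → ≤-trans (m≤n+m _ _) (rank≤ S≤y 1≤i i≤n 1≤k k≤n))))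
  (λ e≤y∧S⊆ → ⇒bruhat n _ y (λ {i} {k} 1≤i i≤n 1≤k k≤n →
     subst (_≤ rankCount y i k) (sym (rankCount-blocks S tl i k))
           (from-parts (∧-conicalˡ _ _ e≤y∧S⊆) (∧-conicalʳ (bruhat n _ y) _ e≤y∧S⊆) 1≤i i≤n 1≤k k≤n)))
  where
  e = blocks (unswapped (length S)) 0 tl
  rank≤ : bruhat n (blocks S 0 tl) y ≡ true → ∀ {i k} → 1 ≤ i → i ≤ n → 1 ≤ k → k ≤ n →
          rankCount e i k + excess S 0 i k ≤ rankCount y i k
  rank≤ S≤y {i} {k} 1≤i i≤n 1≤k k≤n = subst (_≤ rankCount y i k) (rankCount-blocks S tl i k) (bruhat⇒ n _ y S≤y 1≤i i≤n 1≤k k≤n)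
  from-parts : bruhat n e y ≡ true → S ⊆ᵇ swapPattern y 0 (length S) ≡ true → ∀ {i k} → 1 ≤ i → i ≤ n → 1 ≤ k → k ≤ n →
               rankCount e i k + excess S 0 i k ≤ rankCount y i k
  from-parts e≤y S⊆ {i} {k} 1≤i i≤n 1≤k k≤n with excess-⊆ S 0 y S⊆ i k
  ... | inj₁ e≡0 rewrite e≡0 | +-identityʳ (rankCount e i k) = bruhat⇒ n e y e≤y 1≤i i≤n 1≤k k≤n
  ... | inj₂ (d′ , fits′ , refl , refl , e≡1 , rank≥1) =
    subst (_≤ rankCount y i k) (sym (cong₂ _+_ (rankCount-unswapped-at-block (length S) tl d′ fits′) e≡1)) rank≥1

posOf-head : ∀ x xs → posOf (x ∷ xs) x ≡ 1
posOf-head x xs rewrite ≡ᵇ-refl x = refl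

posOf-∷ : ∀ {x} xs {a} → x ≢ a → posOf xs a ≢ 0 → posOf (x ∷ xs) a ≡ suc (posOf xs a)
posOf-∷ xs x≢a pos≢0 rewrite ≢⇒≡ᵇ-false x≢a | ≢⇒≡ᵇ-false pos≢0 = refl

posOf≢0 : ∀ {a xs} → a ∈ xs → posOf xs a ≢ 0
posOf≢0 {a} {x ∷ xs} (here refl) rewrite ≡ᵇ-refl a = λ ()
posOf≢0 {a} {x ∷ xs} (there a∈xs) with x ≡ᵇ a
... | true  = λ ()
... | false rewrite ≢⇒≡ᵇ-false (posOf≢0 a∈xs) = λ ()

posOf-++ : ∀ P {xs a} → a ∉ P → posOf xs a ≢ 0 → posOf (P ++ xs) a ≡ length P + posOf xs a
posOf-++ []      a∉P pos≢0 = refl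
posOf-++ (p ∷ P) {xs} {a} a∉P pos≢0 =
  trans (posOf-∷ {p} (P ++ xs) (λ { refl → a∉P (here refl) }) (λ eq → pos≢0 (m+n≡0⇒n≡0 (length P) (trans (sym ih) eq)))) (cong suc ih)
  where
  ih : posOf (P ++ xs) a ≡ length P + posOf xs a
  ih = posOf-++ P (a∉P ∘ there) pos≢0

posOf-++-∷ : ∀ P {a R} → a ∉ P → posOf (P ++ a ∷ R) a ≡ suc (length P)
posOf-++-∷ P {a} {R} a∉P =
  trans (posOf-++ P a∉P (λ eq → 0≢1+n (trans (sym eq) (posOf-head a R)))) (trans (cong (length P +_) (posOf-head a R)) (+-comm (length P) 1))

posOf≤length : ∀ xs a → posOf xs a ≤ length xs
posOf≤length []       a = z≤n
posOf≤length (x ∷ xs) a with x ≡ᵇ a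
... | true  = s≤s z≤n
... | false with posOf xs a ≡ᵇ 0
...   | true  = z≤n
...   | false = s≤s (posOf≤length xs a)

posOf≡suc : ∀ xs a p → posOf xs a ≡ suc p → ∃₂ λ P R → xs ≡ P ++ a ∷ R × length P ≡ p × a ∉ P
posOf≡suc (x ∷ xs) a p pos≡ with x ≡ᵇ a in x=a
posOf≡suc (x ∷ xs) a zero    pos≡ | true = [] , xs , cong (_∷ xs) (≡ᵇ-true⇒≡ x=a) , refl , λ ()
posOf≡suc (x ∷ xs) a (suc p) pos≡ | true with () ← suc-injective pos≡
... | false with posOf xs a ≡ᵇ 0 in pos=0
...   | true with () ← pos≡
posOf≡suc (x ∷ xs) a zero    pos≡ | false | false = ⊥-elim (≡ᵇ-false⇒≢ pos=0 (suc-injective pos≡))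
posOf≡suc (x ∷ xs) a (suc p) pos≡ | false | false with posOf≡suc xs a p (suc-injective pos≡)
... | P , R , xs≡ , |P|≡p , a∉P =
  x ∷ P , R , cong (x ∷_) xs≡ , cong suc |P|≡p , λ { (here refl) → ≡ᵇ-false⇒≢ {a} x=a refl ; (there a∈P) → a∉P a∈P }

∈-block⁻ : ∀ b d r {x} → x ∈ block b d r → x ≡ suc d ⊎ x ≡ suc (suc d) ⊎ x ∈ r
∈-block⁻ false d r (here refl)         = inj₁ refl
∈-block⁻ false d r (there (here refl)) = inj₂ (inj₁ refl)
∈-block⁻ true  d r (here refl)         = inj₂ (inj₁ refl)
∈-block⁻ true  d r (there (here refl)) = inj₁ refl
∈-block⁻ false d r (there (there x∈r)) = inj₂ (inj₂ x∈r)
∈-block⁻ true  d r (there (there x∈r)) = inj₂ (inj₂ x∈r)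

∈-block⁺ : ∀ b d r {x} → x ≡ suc d ⊎ x ≡ suc (suc d) ⊎ x ∈ r → x ∈ block b d r
∈-block⁺ false d r (inj₁ refl)        = here refl
∈-block⁺ false d r (inj₂ (inj₁ refl)) = there (here refl)
∈-block⁺ true  d r (inj₁ refl)        = there (here refl)
∈-block⁺ true  d r (inj₂ (inj₁ refl)) = here refl
∈-block⁺ false d r (inj₂ (inj₂ x∈r))  = there (there x∈r)
∈-block⁺ true  d r (inj₂ (inj₂ x∈r))  = there (there x∈r)

∈-blocks-reswap : ∀ S S′ d tl {x} → length S ≡ length S′ → x ∈ blocks S d tl → x ∈ blocks S′ d tl
∈-blocks-reswap []      []        d tl _       x∈ = x∈
∈-blocks-reswap (b ∷ S) (b′ ∷ S′) d tl |S|≡|S′| x∈ with ∈-block⁻ b d _ x∈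
... | inj₁ x≡              = ∈-block⁺ b′ d _ (inj₁ x≡)
... | inj₂ (inj₁ x≡)       = ∈-block⁺ b′ d _ (inj₂ (inj₁ x≡))
... | inj₂ (inj₂ x∈blocks) = ∈-block⁺ b′ d _ (inj₂ (inj₂ (∈-blocks-reswap S S′ (suc (suc d)) tl (suc-injective |S|≡|S′|) x∈blocks)))

∈-blocks⁻ : ∀ S d tl {x} → x ∈ blocks S d tl → (d < x × x ≤ d + 2 * length S) ⊎ x ∈ tl
∈-blocks⁻ S d tl x∈ with ∈-++⁻ (rangeFrom d (2 * length S))
                              (subst (_ ∈_) (blocks-unswapped (length S) d tl)
                                     (∈-blocks-reswap S (unswapped (length S)) d tl (sym (length-replicate _)) x∈))
... | inj₁ x∈range = inj₁ (∈-rangeFrom⁻ x∈range)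
... | inj₂ x∈tl    = inj₂ x∈tl

∈-blocks⁺ : ∀ S d tl {x} → (d < x × x ≤ d + 2 * length S) ⊎ x ∈ tl → x ∈ blocks S d tl
∈-blocks⁺ S d tl x∈ = ∈-blocks-reswap (unswapped (length S)) S d tl (length-replicate _)
  (subst (_ ∈_) (sym (blocks-unswapped (length S) d tl)) (from-range x∈))
  where
  from-range : _ → _ ∈ rangeFrom d (2 * length S) ++ tl
  from-range (inj₁ (d<x , x≤)) = ∈-++⁺ˡ (∈-rangeFrom⁺ d<x x≤)
  from-range (inj₂ x∈tl)       = ∈-++⁺ʳ _ x∈tl

even-suc : ∀ d → even (suc d) ≡ not (even d)
even-suc zero          = refl
even-suc (suc zero)    = refl
even-suc (suc (suc d)) = even-suc d

even-2* : ∀ j → even (2 * j) ≡ true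
even-2* zero    = refl
even-2* (suc j) rewrite *-suc 2 j = even-2* j

module _ {n d : ℕ} (d-even : even d ≡ true) where

  star-odd : suc (suc d) ≤ n → star n (suc d) ≡ suc (suc d)
  star-odd d+2≤n rewrite even-suc d | d-even | ≤⇒≤ᵇ-true {suc d + 1} (subst (_≤ n) (+-comm 1 (suc d)) d+2≤n) = +-comm (suc d) 1

  star-even : star n (suc (suc d)) ≡ suc d
  star-even rewrite even-suc (suc d) | even-suc d | d-even = refl

posOf-block : ∀ b P R → (∀ {p} → p ∈ P → p ≤ length P) →
  ∣ posOf (P ++ block b (length P) R) (suc (length P)) - posOf (P ++ block b (length P) R) (suc (suc (length P))) ∣ ≡ 1
posOf-block b P R P≤d = begin
  ∣ posOf (P ++ blk) (suc d) - posOf (P ++ blk) (suc (suc d)) ∣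
    ≡⟨ cong₂ ∣_-_∣ (posOf-++ P (λ d+1∈P → 1+n≰n (P≤d d+1∈P)) (posOf≢0 (∈-block⁺ b d R (inj₁ refl))))
                   (posOf-++ P (λ d+2∈P → 1+n≰n (≤-trans (n≤1+n _) (P≤d d+2∈P))) (posOf≢0 (∈-block⁺ b d R (inj₂ (inj₁ refl))))) ⟩
  ∣ d + posOf blk (suc d) - d + posOf blk (suc (suc d)) ∣
    ≡⟨ ∣m+n-m+o∣≡∣n-o∣ d _ _ ⟩
  ∣ posOf blk (suc d) - posOf blk (suc (suc d)) ∣
    ≡⟨ within-block b ⟩
  1 ∎
  where
  open ≡-Reasoning
  d = length P
  blk = block b d R
  within-block : ∀ b → ∣ posOf (block b d R) (suc d) - posOf (block b d R) (suc (suc d)) ∣ ≡ 1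
  within-block false rewrite posOf-head (suc d) (suc (suc d) ∷ R)
                           | posOf-∷ {suc d} (suc (suc d) ∷ R) (1+n≢n ∘ sym) (posOf≢0 {xs = suc (suc d) ∷ R} (here refl))
                           | posOf-head (suc (suc d)) R = refl
  within-block true  rewrite posOf-head (suc (suc d)) (suc d ∷ R)
                           | posOf-∷ {suc (suc d)} (suc d ∷ R) 1+n≢n (posOf≢0 {xs = suc d ∷ R} (here refl))
                           | posOf-head (suc d) R = refl

block-++ : ∀ b d r → block b d [] ++ r ≡ block b d r
block-++ false d r = refl
block-++ true  d r = refl

d+2≤d+2*suc : ∀ d s → suc (suc d) ≤ d + 2 * suc s
d+2≤d+2*suc d s = subst (suc (suc d) ≤_) (sym (+-2*suc d s)) (s≤s (s≤s (m≤m+n d _)))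

length-prefix-block : ∀ P b {d} → length P ≡ d → length (P ++ block b d []) ≡ suc (suc d)
length-prefix-block P b {d} |P|≡d = trans (length-++ P) (trans (cong₂ _+_ |P|≡d (length-block b d [])) (+-comm d 2))

prefix-block-bounded : ∀ P b {d} → (∀ {p} → p ∈ P → p ≤ d) → ∀ {p} → p ∈ P ++ block b d [] → p ≤ suc (suc d)
prefix-block-bounded P b {d} P≤d p∈ with ∈-++⁻ P p∈
... | inj₁ p∈P = ≤-trans (P≤d p∈P) (≤-trans (n≤1+n d) (n≤1+n (suc d)))
... | inj₂ p∈B with ∈-block⁻ b d [] p∈B
...   | inj₁ refl        = n≤1+n _
...   | inj₂ (inj₁ refl) = ≤-refl

blocks-adjacent : ∀ n S P d tl → length P ≡ d → (∀ {p} → p ∈ P → p ≤ d) → even d ≡ true → d + 2 * length S ≤ n →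
  ∀ {i} → d < i → i ≤ d + 2 * length S → ∣ posOf (P ++ blocks S d tl) i - posOf (P ++ blocks S d tl) (star n i) ∣ ≤ 1
blocks-adjacent n []      P d tl _    _   _      _    d<i i≤d = ⊥-elim (<⇒≱ d<i (subst (_ ≤_) (+-identityʳ d) i≤d))
blocks-adjacent n (b ∷ S) P d tl refl P≤d d-even fits {i} d<i i≤ with i ≟ suc d | i ≟ suc (suc d)
... | yes refl | _ rewrite star-odd d-even (≤-trans (d+2≤d+2*suc d (length S)) fits) = ≤-reflexive (posOf-block b P _ P≤d)
... | no _ | yes refl = subst (λ j → ∣ posOf (P ++ block b d _) (suc (suc d)) - posOf (P ++ block b d _) j ∣ ≤ 1) (sym (star-even {n} d-even))
  (≤-reflexive (trans (∣-∣-comm (posOf (P ++ block b d _) (suc (suc d))) _) (posOf-block b P _ P≤d)))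
... | no i≢d+1 | no i≢d+2 =
  subst (λ L → ∣ posOf L i - posOf L (star n i) ∣ ≤ 1) (trans (++-assoc P (block b d []) _) (cong (P ++_) (block-++ b d _)))
        (blocks-adjacent n S (P ++ block b d []) (suc (suc d)) tl (length-prefix-block P b refl) (prefix-block-bounded P b P≤d) d-even
                         (subst (_≤ n) (+-2*suc d (length S)) fits) d+2<i (subst (i ≤_) (+-2*suc d (length S)) i≤))
  where
  d+2<i : suc (suc d) < i
  d+2<i = ≤∧≢⇒< (≤∧≢⇒< d<i (i≢d+1 ∘ sym)) (i≢d+2 ∘ sym)

-- The values above 2m, which follow the pairs: none for n = 2m, and 2m+1 for n = 2m+1.
record Tail (m n : ℕ) (tl : List ℕ) : Set where
  field
    n≡       : n ≡ 2 * m + length tl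
    short    : length tl ≤ 1
    bounded  : ∀ {x} → x ∈ tl → 2 * m < x × x ≤ n
    complete : ∀ {a} → 2 * m < a → a ≤ n → a ∈ tl

  2m≤n : 2 * m ≤ n
  2m≤n = ≤-trans (m≤m+n (2 * m) (length tl)) (≤-reflexive (sym n≡))

tail-even : ∀ m → Tail m (2 * m) []
tail-even m = record { n≡ = sym (+-identityʳ _) ; short = z≤n ; bounded = λ () ; complete = λ 2m<a a≤2m → ⊥-elim (<⇒≱ 2m<a a≤2m) }

tail-odd : ∀ m → Tail m (2 * m + 1) (2 * m + 1 ∷ [])
tail-odd m = record
  { n≡       = refl
  ; short    = s≤s z≤n
  ; bounded  = λ { (here refl) → 2m<2m+1 , ≤-refl }
  ; complete = λ {a} 2m<a a≤2m+1 → here (≤-antisym a≤2m+1 (subst (_≤ a) (+-comm 1 (2 * m)) 2m<a))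
  }
  where
  2m<2m+1 : 2 * m < 2 * m + 1
  2m<2m+1 = subst (2 * m <_) (+-comm 1 (2 * m)) ≤-refl

InW-blocks : ∀ {m n tl} → Tail m n tl → ∀ S → length S ≡ m → InW n (blocks S 0 tl)
InW-blocks {m} {n} {tl} tail S refl = record
  { length≡  = trans (length-blocks S 0 tl) (sym n≡)
  ; bounded  = bounded′
  ; complete = complete′
  ; adjacent = λ 1≤i i≤n-1 → blocks-adjacent n S [] 0 tl refl (λ ()) refl 2m≤n 1≤i (≤-trans i≤n-1 n-1≤2m)
  }
  where
  open Tail tail
  bounded′ : ∀ {x} → x ∈ blocks S 0 tl → 1 ≤ x × x ≤ n
  bounded′ x∈ with ∈-blocks⁻ S 0 tl x∈
  ... | inj₁ (0<x , x≤2m) = 0<x , ≤-trans x≤2m 2m≤n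
  ... | inj₂ x∈tl         = ≤-trans (s≤s z≤n) (proj₁ (bounded x∈tl)) , proj₂ (bounded x∈tl)
  complete′ : ∀ {a} → 1 ≤ a → a ≤ n → a ∈ blocks S 0 tl
  complete′ {a} 1≤a a≤n with a ≤? 2 * length S
  ... | yes a≤2m = ∈-blocks⁺ S 0 tl (inj₁ (1≤a , a≤2m))
  ... | no  a≰2m = ∈-blocks⁺ S 0 tl (inj₂ (complete (≰⇒> a≰2m) a≤n))
  n-1≤2m : n ∸ 1 ≤ 2 * length S
  n-1≤2m = begin
    n ∸ 1                           ≡⟨ cong (_∸ 1) n≡ ⟩
    2 * length S + length tl ∸ 1    ≤⟨ ∸-monoˡ-≤ 1 (+-monoʳ-≤ (2 * length S) short) ⟩
    2 * length S + 1 ∸ 1            ≡⟨ m+n∸n≡m (2 * length S) 1 ⟩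
    2 * length S                    ∎
    where open ≤-Reasoning

eqList-blocks : ∀ S T d tl → length S ≡ length T → eqList (blocks S d tl) (blocks T d tl) ≡ does (S ≟ᴮ T)
eqList-blocks []          []          d tl _  = eqList-refl tl
eqList-blocks (false ∷ S) (false ∷ T) d tl eq rewrite ≡ᵇ-refl d = eqList-blocks S T (suc (suc d)) tl (suc-injective eq)
eqList-blocks (true ∷ S)  (true ∷ T)  d tl eq rewrite ≡ᵇ-refl d = eqList-blocks S T (suc (suc d)) tl (suc-injective eq)
eqList-blocks (false ∷ S) (true ∷ T)  d tl _  rewrite ≢⇒≡ᵇ-false (1+n≢n {d} ∘ sym) = refl
eqList-blocks (true ∷ S)  (false ∷ T) d tl _  rewrite ≢⇒≡ᵇ-false (1+n≢n {suc d}) = refl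

next-to : ∀ {y} P {a a′ R} → y ≡ P ++ a ∷ R → a ∉ P → a′ ∉ P → a ≢ a′ → a′ ∈ y →
          ∣ posOf y a - posOf y a′ ∣ ≤ 1 → ∃ λ R′ → R ≡ a′ ∷ R′
next-to P {a} {a′} {R} refl a∉P a′∉P a≢a′ a′∈y close = at-front (posOf≡suc R a′ 0 (pos≡1 (posOf R a′) pos≢0 pos≤1))
  where
  at-front : (∃₂ λ Q R′ → R ≡ Q ++ a′ ∷ R′ × length Q ≡ 0 × a′ ∉ Q) → ∃ λ R′ → R ≡ a′ ∷ R′
  at-front ([] , R′ , R≡ , _) = R′ , R≡
  a′∈R : a′ ∈ R
  a′∈R with ∈-++⁻ P a′∈y
  ... | inj₁ a′∈P              = ⊥-elim (a′∉P a′∈P)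
  ... | inj₂ (here a′≡a)       = ⊥-elim (a≢a′ (sym a′≡a))
  ... | inj₂ (there a′∈R)      = a′∈R
  pos≢0 : posOf R a′ ≢ 0
  pos≢0 = posOf≢0 a′∈R
  pos≤1 : posOf R a′ ≤ 1
  pos≤1 = subst (_≤ 1)
    (trans (cong₂ ∣_-_∣ (trans (posOf-++-∷ P a∉P) (sym (+-identityʳ _)))
                        (trans (posOf-++ P a′∉P (λ eq → 0≢1+n (trans (sym eq) (posOf-∷ R a≢a′ pos≢0))))
                               (trans (cong (length P +_) (posOf-∷ R a≢a′ pos≢0)) (+-suc (length P) _))))
           (∣m+n-m+o∣≡∣n-o∣ (suc (length P)) 0 (posOf R a′)))
    close
  pos≡1 : ∀ p → p ≢ 0 → p ≤ 1 → p ≡ 1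
  pos≡1 zero          p≢0 _         = ⊥-elim (p≢0 refl)
  pos≡1 (suc zero)    _   _         = refl
  pos≡1 (suc (suc p)) _   (s≤s ())

blockFirst blockSecond : Bool → ℕ → ℕ
blockFirst  false d = suc d
blockFirst  true  d = suc (suc d)
blockSecond false d = suc (suc d)
blockSecond true  d = suc d

block≡ : ∀ b d R → block b d R ≡ blockFirst b d ∷ blockSecond b d ∷ R
block≡ false d R = refl
block≡ true  d R = refl

InW-pair-adjacent : ∀ {n y d} → InW n y → even d ≡ true → suc (suc d) ≤ n → ∣ posOf y (suc d) - posOf y (suc (suc d)) ∣ ≤ 1
InW-pair-adjacent {n} {y} {d} y∈W d-even d+2≤n =
  subst (λ j → ∣ posOf y (suc d) - posOf y j ∣ ≤ 1) (star-odd d-even d+2≤n)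
        (InW.adjacent y∈W (s≤s z≤n) (∸-monoˡ-≤ 1 d+2≤n))

block-completes : ∀ {n y} P b {d R} → InW n y → y ≡ P ++ blockFirst b d ∷ R → (∀ {p} → p ∈ P → p ≤ d) →
                  even d ≡ true → suc (suc d) ≤ n → ∃ λ R′ → R ≡ blockSecond b d ∷ R′
block-completes {n} {y} P b {d} y∈W y≡ P≤d d-even d+2≤n =
  next-to P y≡ (first∉P b) (second∉P b) (first≢second b) (InW.complete y∈W (1≤second b) (second≤n b)) (close b)
  where
  d+1∉P : suc d ∉ P
  d+1∉P d+1∈P = 1+n≰n (P≤d d+1∈P)
  d+2∉P : suc (suc d) ∉ P
  d+2∉P d+2∈P = 1+n≰n (≤-trans (n≤1+n _) (P≤d d+2∈P))
  first∉P : ∀ b → blockFirst b d ∉ P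
  first∉P  false = d+1∉P
  first∉P  true  = d+2∉P
  second∉P : ∀ b → blockSecond b d ∉ P
  second∉P false = d+2∉P
  second∉P true  = d+1∉P
  first≢second : ∀ b → blockFirst b d ≢ blockSecond b d
  first≢second false = 1+n≢n ∘ sym
  first≢second true  = 1+n≢n
  1≤second : ∀ b → 1 ≤ blockSecond b d
  1≤second false = s≤s z≤n
  1≤second true  = s≤s z≤n
  second≤n : ∀ b → blockSecond b d ≤ n
  second≤n false = d+2≤n
  second≤n true  = ≤-trans (n≤1+n _) d+2≤n
  close : ∀ b → ∣ posOf y (blockFirst b d) - posOf y (blockSecond b d) ∣ ≤ 1
  close false = InW-pair-adjacent y∈W d-even d+2≤n
  close true  = subst (_≤ 1) (∣-∣-comm (posOf y (suc d)) _) (InW-pair-adjacent y∈W d-even d+2≤n)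

HeadsAt : ℕ → List ℕ → Set
HeadsAt m y = ∀ {j P r R} → j < m → y ≡ P ++ r ∷ R → length P ≡ 2 * j → (∀ {p} → p ∈ P → p ≤ 2 * j) →
              ∃ λ b → r ≡ blockFirst b (2 * j)

rest≡tail : ∀ {m n tl y} P {R} → Tail m n tl → InW n y → y ≡ P ++ R → length P ≡ 2 * m → (∀ {p} → p ∈ P → p ≤ 2 * m) → R ≡ tl
rest≡tail {m} {n} {tl} {y} P {R} tail y∈W y≡ |P|≡2m P≤2m = short-list-ext tl R short |R|≡|tl| tl⊆R
  where
  open Tail tail
  |R|≡|tl| : length R ≡ length tl
  |R|≡|tl| = +-cancelˡ-≡ (2 * m) _ _ (begin
    2 * m + length R       ≡⟨ cong (_+ length R) |P|≡2m ⟨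
    length P + length R    ≡⟨ length-++ P ⟨
    length (P ++ R)        ≡⟨ cong length y≡ ⟨
    length y               ≡⟨ InW.length≡ y∈W ⟩
    n                      ≡⟨ n≡ ⟩
    2 * m + length tl      ∎)
    where open ≡-Reasoning
  tl⊆R : ∀ {t} → t ∈ tl → t ∈ R
  tl⊆R t∈tl with ∈-++⁻ P (subst (_ ∈_) y≡ (InW.complete y∈W (≤-trans (s≤s z≤n) (proj₁ (bounded t∈tl))) (proj₂ (bounded t∈tl))))
  ... | inj₁ t∈P = ⊥-elim (<⇒≱ (proj₁ (bounded t∈tl)) (P≤2m t∈P))
  ... | inj₂ t∈R = t∈R
  short-list-ext : ∀ tl R → length tl ≤ 1 → length R ≡ length tl → (∀ {t} → t ∈ tl → t ∈ R) → R ≡ tl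
  short-list-ext []          []       _        _ _    = refl
  short-list-ext (t ∷ [])    (r ∷ []) _        _ tl⊆R with tl⊆R (here refl)
  ... | here refl = refl
  short-list-ext (_ ∷ _ ∷ _) _        (s≤s ()) _ _

-- Reading y pair by pair: each pair starts with 2j+1 or 2j+2, and adjacency in W puts its partner right after it.
module _ {m n tl y} (tail : Tail m n tl) (y∈W : InW n y) (heads : HeadsAt m y) where

  InW⇒blocks-after : ∀ k {j P R} → j + k ≡ m → y ≡ P ++ R → length P ≡ 2 * j → (∀ {p} → p ∈ P → p ≤ 2 * j) →
                     ∃ λ S → length S ≡ k × R ≡ blocks S (2 * j) tl
  InW⇒blocks-after zero    {j} {P} j+0≡m y≡ |P|≡2j P≤2j =
    [] , refl , rest≡tail P tail y∈W y≡ (trans |P|≡2j (cong (2 *_) j≡m)) (λ p∈ → subst (λ c → _ ≤ 2 * c) j≡m (P≤2j p∈))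
    where j≡m = trans (sym (+-identityʳ j)) j+0≡m
  InW⇒blocks-after (suc k) {j} {P} {[]} j+k+1≡m y≡ |P|≡2j P≤2j = ⊥-elim (<⇒≱ 2j<n (≤-reflexive |y|≡2j))
    where
    2j<n : 2 * j < n
    2j<n = ≤-trans (*-monoʳ-< 2 (+-suc≡⇒< j+k+1≡m)) (Tail.2m≤n tail)
    |y|≡2j : n ≡ 2 * j
    |y|≡2j = trans (sym (InW.length≡ y∈W)) (trans (cong length y≡) (trans (length-++ P) (trans (+-identityʳ _) |P|≡2j)))
  InW⇒blocks-after (suc k) {j} {P} {r ∷ R} j+k+1≡m y≡ |P|≡2j P≤2j with heads j<m y≡ |P|≡2j P≤2j
    where
    j<m : j < m
    j<m = +-suc≡⇒< j+k+1≡m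
  ... | b , refl with block-completes P b y∈W y≡ P≤2j (even-2* j) 2j+2≤n
    where
    2j+2≤n : suc (suc (2 * j)) ≤ n
    2j+2≤n = ≤-trans (≤-reflexive (sym (*-suc 2 j))) (≤-trans (*-monoʳ-≤ 2 (+-suc≡⇒< j+k+1≡m)) (Tail.2m≤n tail))
  ... | R₂ , refl with InW⇒blocks-after k (trans (sym (+-suc j k)) j+k+1≡m) y≡′
                                  (trans (length-prefix-block P b |P|≡2j) (sym (*-suc 2 j)))
                                  (λ {p} p∈ → subst (p ≤_) (sym (*-suc 2 j)) (prefix-block-bounded P b P≤2j p∈))
    where
    y≡′ : y ≡ (P ++ block b (2 * j) []) ++ R₂
    y≡′ = trans y≡ (trans (cong (P ++_) (trans (sym (block≡ b (2 * j) R₂)) (sym (block-++ b (2 * j) R₂)))) (sym (++-assoc P _ R₂)))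
  ... | S , |S|≡k , R₂≡ =
    b ∷ S , cong suc |S|≡k , trans (sym (block≡ b (2 * j) R₂)) (cong (block b (2 * j)) (trans R₂≡ (cong (λ c → blocks S c tl) (*-suc 2 j))))

  InW⇒blocks : ∃ λ S → length S ≡ m × y ≡ blocks S 0 tl
  InW⇒blocks = InW⇒blocks-after m refl refl refl (λ ())

at-++-∷ : ∀ P r R → at (P ++ r ∷ R) (suc (length P)) ≡ r
at-++-∷ []      r R = refl
at-++-∷ (p ∷ P) r R = at-++-∷ P r R

heads-from-odd-entries : ∀ m y → (∀ {j} → j < m → ∃ λ b → at y (suc (2 * j)) ≡ blockFirst b (2 * j)) → HeadsAt m y
heads-from-odd-entries m y odd {j} {P} {r} {R} j<m refl |P|≡2j _ with odd j<m
... | b , at≡ = b , trans (sym (trans (cong (λ c → at (P ++ r ∷ R) (suc c)) (sym |P|≡2j)) (at-++-∷ P r R))) at≡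

swapPattern-all-false : ∀ y d k → all not (swapPattern y d k) ≡ true → ∀ {j} → j < k →
                        rankCount y (suc (d + 2 * j)) (suc (suc (d + 2 * j))) ≡ 0
swapPattern-all-false y d (suc k) none {zero}  _ rewrite +-identityʳ d with rankCount y (suc d) (suc (suc d))
... | zero = refl
... | suc _ with () ← none
swapPattern-all-false y d (suc k) none {suc j} (s≤s j<k) rewrite +-2*suc d j =
  swapPattern-all-false y (suc (suc d)) k (∧-conicalʳ _ _ none) j<k

all-not⇒unswapped : ∀ S → all not S ≡ true → S ≡ unswapped (length S)
all-not⇒unswapped []          _    = refl
all-not⇒unswapped (false ∷ S) none = cong (false ∷_) (all-not⇒unswapped S none)

module _ {m n tl y} (tail : Tail m n tl) (y∈W : InW n y) where

  private
    e = blocks (unswapped m) 0 tl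

  -- Position 2j+1 of y must hold 2j+1: e ≤ y forces a value ≥ 2j+1 there, an unswapped pattern forbids one ≥ 2j+2.
  heads-unswapped : bruhat n e y ≡ true → all not (swapPattern y 0 m) ≡ true → HeadsAt m y
  heads-unswapped e≤y none {j} {P} {r} {R} j<m y≡ |P|≡2j P≤2j =
    false , ≤-antisym (≤-pred (≤ᵇ-false⇒> (bit≡0 (suc (suc (2 * j)) ≤ᵇ r) r<2j+2)))
                      (≤ᵇ-true⇒≤ (bit≥1 (suc (2 * j) ≤ᵇ r) r≥2j+1))
    where
    2j<2m : 2 * j < 2 * m
    2j<2m = *-monoʳ-< 2 j<m
    2j+1≤n : suc (2 * j) ≤ n
    2j+1≤n = ≤-trans 2j<2m (Tail.2m≤n tail)
    rank-at : ∀ k → 2 * j < k → rankCount y (suc (2 * j)) k ≡ bit (k ≤ᵇ r)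
    rank-at k 2j<k = begin
      rankCount y (suc (2 * j)) k
        ≡⟨ cong₂ (λ L i → rankCount L i k) y≡ (trans (+-comm 1 (2 * j)) (cong (_+ 1) (sym |P|≡2j))) ⟩
      rankCount (P ++ r ∷ R) (length P + 1) k
        ≡⟨ rankCount-++ P (r ∷ R) 1 k ⟩
      rankCount P (length P) k + rankCount (r ∷ R) 1 k
        ≡⟨ cong₂ _+_ (rankCount-below P (length P) k (λ p∈ → ≤-<-trans (P≤2j p∈) 2j<k)) (rankCount-∷ r R 0 k) ⟩
      bit (k ≤ᵇ r) + 0
        ≡⟨ +-identityʳ _ ⟩
      bit (k ≤ᵇ r) ∎
      where open ≡-Reasoning
    r≥2j+1 : 1 ≤ bit (suc (2 * j) ≤ᵇ r)
    r≥2j+1 = subst (1 ≤_) (rank-at (suc (2 * j)) ≤-refl)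
      (≤-trans (≤-reflexive (sym (trans (cong (λ L → rankCount L (suc (2 * j)) (suc (2 * j))) (blocks-unswapped m 0 tl))
                                        (rankCount-rangeFrom-diag 0 (2 * m) tl (2 * j) 2j<2m))))
               (bruhat⇒ n e y e≤y (s≤s z≤n) 2j+1≤n (s≤s z≤n) 2j+1≤n))
    r<2j+2 : bit (suc (suc (2 * j)) ≤ᵇ r) ≡ 0
    r<2j+2 = trans (sym (rank-at (suc (suc (2 * j))) (n≤1+n _))) (swapPattern-all-false y 0 m none j<m)
    bit≡0 : ∀ b → bit b ≡ 0 → b ≡ false
    bit≡0 false _ = refl
    bit≥1 : ∀ b → 1 ≤ bit b → b ≡ true
    bit≥1 true _ = refl

  unswapped-below⇒identity : bruhat n e y ≡ true → all not (swapPattern y 0 m) ≡ true → y ≡ e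
  unswapped-below⇒identity e≤y none with InW⇒blocks tail y∈W (heads-unswapped e≤y none)
  ... | S , refl , refl = cong (λ T → blocks T 0 tl) (all-not⇒unswapped S (subst (λ A → all not A ≡ true) (swapPattern-blocks S tl) none))

-- Decoding (j, τ, T)

⌊2*n/2⌋≡n : ∀ n → ⌊ 2 * n /2⌋ ≡ n
⌊2*n/2⌋≡n zero    = refl
⌊2*n/2⌋≡n (suc n) rewrite +-suc n (n + 0) = cong suc (⌊2*n/2⌋≡n n)

⌊1+2*n/2⌋≡n : ∀ n → ⌊ suc (2 * n) /2⌋ ≡ n
⌊1+2*n/2⌋≡n zero    = refl
⌊1+2*n/2⌋≡n (suc n) rewrite +-suc n (n + 0) = cong suc (⌊1+2*n/2⌋≡n n)

⌊blockFirst+1/2⌋ : ∀ b j → ⌊ blockFirst b (2 * j) + 1 /2⌋ ≡ suc j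
⌊blockFirst+1/2⌋ false j = trans (cong ⌊_/2⌋ (+-comm (suc (2 * j)) 1)) (cong suc (⌊2*n/2⌋≡n j))
⌊blockFirst+1/2⌋ true  j = trans (cong ⌊_/2⌋ (+-comm (suc (suc (2 * j))) 1)) (cong suc (⌊1+2*n/2⌋≡n j))

⌊1+x/2⌋≡1+j⇒blockFirst : ∀ x j → ⌊ suc x /2⌋ ≡ suc j → ∃ λ b → x ≡ blockFirst b (2 * j)
⌊1+x/2⌋≡1+j⇒blockFirst zero                j       ()
⌊1+x/2⌋≡1+j⇒blockFirst (suc zero)          zero    _  = false , refl
⌊1+x/2⌋≡1+j⇒blockFirst (suc (suc zero))    zero    _  = true , refl
⌊1+x/2⌋≡1+j⇒blockFirst (suc (suc (suc x))) zero    eq with () ← suc-injective eq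
⌊1+x/2⌋≡1+j⇒blockFirst (suc zero)          (suc j) ()
⌊1+x/2⌋≡1+j⇒blockFirst (suc (suc zero))    (suc j) eq with () ← suc-injective eq
⌊1+x/2⌋≡1+j⇒blockFirst (suc (suc (suc x))) (suc j) eq rewrite +-suc j (j + 0) with ⌊1+x/2⌋≡1+j⇒blockFirst (suc x) j (suc-injective eq)
... | false , refl = false , refl
... | true  , refl = true , refl

even-1+2* : ∀ j → even (suc (2 * j)) ≡ false
even-1+2* j rewrite even-suc (2 * j) | even-2* j = refl

2*suc∸1 : ∀ j → 2 * suc j ∸ 1 ≡ suc (2 * j)
2*suc∸1 j = cong (_∸ 1) (*-suc 2 j)

nth : List Bool → ℕ → Bool
nth []      _       = false
nth (b ∷ S) zero    = b
nth (b ∷ S) (suc j) = nth S j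

at-blocks : ∀ S d tl j → j < length S → at (blocks S d tl) (suc (2 * j)) ≡ blockFirst (nth S j) (d + 2 * j)
at-blocks (b ∷ S) d tl zero    _ rewrite block≡ b d (blocks S (suc (suc d)) tl) | +-identityʳ d = refl
at-blocks (b ∷ S) d tl (suc j) (s≤s j<|S|) rewrite block≡ b d (blocks S (suc (suc d)) tl) | +-2*suc d j | *-suc 2 j =
  at-blocks S (suc (suc d)) tl j j<|S|

map-rangeFrom-id : ∀ (f : ℕ → ℕ) c k → (∀ {j} → j < k → f (suc (c + j)) ≡ suc (c + j)) → map f (rangeFrom c k) ≡ rangeFrom c k
map-rangeFrom-id f c zero    _    = refl
map-rangeFrom-id f c (suc k) f≡id =
  cong₂ _∷_ (subst (λ x → f (suc x) ≡ suc x) (+-identityʳ c) (f≡id (s≤s z≤n)))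
            (map-rangeFrom-id f (suc c) k (λ {j} j<k → subst (λ x → f (suc x) ≡ suc x) (+-suc c j) (f≡id (s≤s j<k))))

map-rangeFrom-id⁻ : ∀ (f : ℕ → ℕ) c k → map f (rangeFrom c k) ≡ rangeFrom c k → ∀ {j} → j < k → f (suc (c + j)) ≡ suc (c + j)
map-rangeFrom-id⁻ f c (suc k) eq {zero}  _         = subst (λ x → f (suc x) ≡ suc x) (sym (+-identityʳ c)) (proj₁ (∷-injective eq))
map-rangeFrom-id⁻ f c (suc k) eq {suc j} (s≤s j<k) =
  subst (λ x → f (suc x) ≡ suc x) (sym (+-suc c j)) (map-rangeFrom-id⁻ f (suc c) k (proj₂ (∷-injective eq)) j<k)

decU-blocks : ∀ m S tl → length S ≡ m → decU m (blocks S 0 tl) ≡ range m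
decU-blocks m S tl refl = begin
  map _ (range m)        ≡⟨ cong (map _) (range≡rangeFrom m) ⟩
  map _ (rangeFrom 0 m)  ≡⟨ map-rangeFrom-id _ 0 m (λ {j} j<m → pair-of-j j j<m) ⟩
  rangeFrom 0 m          ≡⟨ range≡rangeFrom m ⟨
  range m                ∎
  where
  open ≡-Reasoning
  pair-of-j : ∀ j → j < length S → ⌊ at (blocks S 0 tl) (2 * suc j ∸ 1) + 1 /2⌋ ≡ suc j
  pair-of-j j j<m rewrite 2*suc∸1 j | at-blocks S 0 tl j j<m = ⌊blockFirst+1/2⌋ (nth S j) j

decU≡range⇒odd-entries : ∀ m v → decU m v ≡ range m → ∀ {j} → j < m → ∃ λ b → at v (suc (2 * j)) ≡ blockFirst b (2 * j)
decU≡range⇒odd-entries m v decU≡ {j} j<m =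
  ⌊1+x/2⌋≡1+j⇒blockFirst (at v (suc (2 * j))) j
    (trans (cong ⌊_/2⌋ (+-comm 1 (at v (suc (2 * j)))))
           (subst (λ i → ⌊ at v i + 1 /2⌋ ≡ suc j) (2*suc∸1 j)
                  (map-rangeFrom-id⁻ _ 0 m (trans (cong (map _) (sym (range≡rangeFrom m))) (trans decU≡ (range≡rangeFrom m))) j<m)))

length-filterᵇ-rangeFrom : ∀ S (p : ℕ → Bool) c → (∀ {j} → j < length S → p (suc (c + j)) ≡ nth S j) →
                           length (filterᵇ p (rangeFrom c (length S))) ≡ countTrue S
length-filterᵇ-rangeFrom []      p c _   = refl
length-filterᵇ-rangeFrom (b ∷ S) p c p≡S with p (suc c) | b | subst (λ x → p (suc x) ≡ b) (+-identityʳ c) (p≡S (s≤s z≤n))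
... | true  | true  | _ = cong suc (length-filterᵇ-rangeFrom S p (suc c) p≡S′)
  where p≡S′ = λ {j} j<|S| → subst (λ x → p (suc x) ≡ nth S j) (+-suc c j) (p≡S (s≤s j<|S|))
... | false | false | _ = length-filterᵇ-rangeFrom S p (suc c) p≡S′
  where p≡S′ = λ {j} j<|S| → subst (λ x → p (suc x) ≡ nth S j) (+-suc c j) (p≡S (s≤s j<|S|))
... | true  | false | ()
... | false | true  | ()

decT-blocks : ∀ m S tl → length S ≡ m → length (decT m (blocks S 0 tl)) ≡ countTrue S
decT-blocks m S tl refl = trans (cong (length ∘ filterᵇ _) (range≡rangeFrom m)) (length-filterᵇ-rangeFrom S _ 0 swapped-at)
  where
  swapped-at : ∀ {j} → j < length S → even (at (blocks S 0 tl) (2 * suc j ∸ 1)) ≡ nth S j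
  swapped-at {j} j<m rewrite 2*suc∸1 j | at-blocks S 0 tl j j<m with nth S j
  ... | true  = even-2* j
  ... | false = even-1+2* j

max∉blocks : ∀ m S → length S ≡ m → 2 * m + 1 ∉ blocks S 0 []
max∉blocks m S refl t∈ with ∈-blocks⁻ S 0 [] t∈
... | inj₁ (_ , t≤2m) = 1+n≰n (subst (_≤ 2 * m) (+-comm (2 * m) 1) t≤2m)

deleteMax-∷ʳ : ∀ m P → 2 * m + 1 ∉ P → deleteMax m (P ++ 2 * m + 1 ∷ []) ≡ P
deleteMax-∷ʳ m P t∉P = begin
  filterᵇ keep (P ++ 2 * m + 1 ∷ [])                 ≡⟨ filter-++ (T? ∘ keep) P _ ⟩
  filterᵇ keep P ++ filterᵇ keep (2 * m + 1 ∷ [])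
    ≡⟨ cong₂ _++_ (filter-all (T? ∘ keep) (All.tabulate kept)) (filter-reject (T? ∘ keep) {2 * m + 1} {[]} dropped) ⟩
  P ++ []                                            ≡⟨ ++-identityʳ P ⟩
  P                                                  ∎
  where
  open ≡-Reasoning
  keep = λ a → not (a ≡ᵇ (2 * m + 1))
  kept : ∀ {x} → x ∈ P → T (keep x)
  kept {x} x∈P rewrite ≢⇒≡ᵇ-false {x} {2 * m + 1} (λ { refl → t∉P x∈P }) = _
  dropped : ¬ T (keep (2 * m + 1))
  dropped rewrite ≡ᵇ-refl (2 * m + 1) = λ ()

deleteMax-blocks : ∀ m S → length S ≡ m → deleteMax m (blocks S 0 (2 * m + 1 ∷ [])) ≡ blocks S 0 []
deleteMax-blocks m S |S|≡m = trans (cong (deleteMax m) (sym (blocks-++ S 0 _))) (deleteMax-∷ʳ m _ (max∉blocks m S |S|≡m))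

decJ-blocks : ∀ m S → length S ≡ m → decJ m (blocks S 0 (2 * m + 1 ∷ [])) ≡ m + 1
decJ-blocks m S refl = begin
  ⌊ posOf (blocks S 0 (t ∷ [])) t + 1 /2⌋         ≡⟨ cong (λ L → ⌊ posOf L t + 1 /2⌋) (blocks-++ S 0 _) ⟨
  ⌊ posOf (blocks S 0 [] ++ t ∷ []) t + 1 /2⌋     ≡⟨ cong (λ p → ⌊ p + 1 /2⌋) (posOf-++-∷ (blocks S 0 []) (max∉blocks m S refl)) ⟩
  ⌊ suc (length (blocks S 0 [])) + 1 /2⌋          ≡⟨ cong (λ l → ⌊ suc l + 1 /2⌋) (length-blocks-[] S 0) ⟩
  ⌊ suc (2 * m) + 1 /2⌋                           ≡⟨ cong ⌊_/2⌋ (trans (+-comm (suc (2 * m)) 1) (sym (*-suc 2 m))) ⟩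
  ⌊ 2 * suc m /2⌋                                 ≡⟨ ⌊2*n/2⌋≡n (suc m) ⟩
  suc m                                           ≡⟨ +-comm 1 m ⟩
  m + 1                                           ∎
  where
  open ≡-Reasoning
  t = 2 * m + 1

formulaEven : ℕ → List ℕ → ℤ
formulaEven m v = if eqList (decU m v) (idPerm m) then signPow (length (decT m v)) else 0ℤ

formulaOdd : ℕ → List ℕ → ℤ
formulaOdd m v = if eqList (decτ m v) (idPerm m) ∧ (decJ m v ≡ᵇ (m + 1)) then signPow (length (decTodd m v)) else 0ℤ

formulaEven-blocks : ∀ m S → length S ≡ m → formulaEven m (blocks S 0 []) ≡ sign S
formulaEven-blocks m S |S|≡m rewrite decU-blocks m S [] |S|≡m | eqList-refl (range m) | decT-blocks m S [] |S|≡m = refl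

formulaOdd-blocks : ∀ m S → length S ≡ m → formulaOdd m (blocks S 0 (2 * m + 1 ∷ [])) ≡ sign S
formulaOdd-blocks m S |S|≡m
  rewrite deleteMax-blocks m S |S|≡m | decU-blocks m S [] |S|≡m | eqList-refl (range m) | decJ-blocks m S |S|≡m
        | ≡ᵇ-refl (m + 1) | decT-blocks m S [] |S|≡m = refl

formulaEven-support : ∀ m {y} → InW (2 * m) y → formulaEven m y ≢ 0ℤ → ∃ λ S → length S ≡ m × y ≡ blocks S 0 []
formulaEven-support m {y} y∈W formula≢0 with eqList (decU m y) (idPerm m) in decU≡
... | false = ⊥-elim (formula≢0 refl)
... | true  = InW⇒blocks (tail-even m) y∈W
                (heads-from-odd-entries m y (decU≡range⇒odd-entries m y (eqList-true⇒≡ decU≡)))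

at-++ˡ : ∀ P R {q} → 1 ≤ q → q ≤ length P → at (P ++ R) q ≡ at P q
at-++ˡ (p ∷ P) R {suc zero}    _ _           = refl
at-++ˡ (p ∷ P) R {suc (suc q)} _ (s≤s q<|P|) = at-++ˡ P R (s≤s z≤n) q<|P|

max-last : ∀ m {y} → InW (2 * m + 1) y → decJ m y ≡ m + 1 → ∃ λ P → y ≡ P ++ 2 * m + 1 ∷ [] × length P ≡ 2 * m × 2 * m + 1 ∉ P
max-last m {y} y∈W decJ≡ with posOf≡suc y t (2 * m) t-last
  where
  t = 2 * m + 1
  |y| : length y ≡ suc (2 * m)
  |y| = trans (InW.length≡ y∈W) (+-comm (2 * m) 1)
  t-last : posOf y t ≡ suc (2 * m)
  t-last with ⌊1+x/2⌋≡1+j⇒blockFirst (posOf y t) m (trans (cong ⌊_/2⌋ (+-comm 1 (posOf y t))) (trans decJ≡ (+-comm m 1)))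
  ... | false , pos≡ = pos≡
  ... | true  , pos≡ = ⊥-elim (1+n≰n (subst₂ _≤_ pos≡ |y| (posOf≤length y t)))
... | P , [] , y≡ , |P|≡2m , t∉P = P , y≡ , |P|≡2m , t∉P
... | P , r ∷ R , y≡ , |P|≡2m , t∉P with () ← suc-injective (+-cancelˡ-≡ (2 * m) 1 (suc (suc (length R)))
  (trans (sym (InW.length≡ y∈W)) (trans (cong length y≡) (trans (length-++ P) (cong (_+ suc (suc (length R))) |P|≡2m)))))

-- Decoding the part before 2m+1 as the identity gives the odd entries of y.
formulaOdd-support : ∀ m {y} → InW (2 * m + 1) y → formulaOdd m y ≢ 0ℤ → ∃ λ S → length S ≡ m × y ≡ blocks S 0 (2 * m + 1 ∷ [])
formulaOdd-support m {y} y∈W formula≢0 with eqList (decτ m y) (idPerm m) in decτ≡ | decJ m y ≡ᵇ (m + 1) in decJ≡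
... | false | _     = ⊥-elim (formula≢0 refl)
... | true  | false = ⊥-elim (formula≢0 refl)
... | true  | true  with max-last m y∈W (≡ᵇ-true⇒≡ decJ≡)
...   | P , y≡ , |P|≡2m , t∉P = InW⇒blocks (tail-odd m) y∈W (heads-from-odd-entries m y odd-entries)
  where
  odd-entries : ∀ {j} → j < m → ∃ λ b → at y (suc (2 * j)) ≡ blockFirst b (2 * j)
  odd-entries {j} j<m with decU≡range⇒odd-entries m P (trans (cong (decU m) (sym (trans (cong (deleteMax m) y≡) (deleteMax-∷ʳ m P t∉P))))
                                                            (eqList-true⇒≡ decτ≡)) j<m
  ... | b , at≡ = b , trans (cong (λ L → at L (suc (2 * j))) y≡)
                            (trans (at-++ˡ P _ (s≤s z≤n) (subst (suc (2 * j) ≤_) (sym |P|≡2m) (*-monoʳ-< 2 j<m))) at≡)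

-- The Möbius recursion on W

∈-Wlist : ∀ {n y} → isW n y ≡ true → y ∈ Wlist n
∈-Wlist {n} {y} y∈W = ∈-filter⁺ (T? ∘ isW n) (∈-words n n y (InW.length≡ y∈W′) (InW.bounded y∈W′)) (≡true⇒T y∈W)
  where
  y∈W′ : InW n y
  y∈W′ = isW⇒InW y∈W

Wlist⇒InW : ∀ {n y} → y ∈ Wlist n → InW n y
Wlist⇒InW {n} y∈ = isW⇒InW (proj₂ (∈-filterᵇ⁻ {p = isW n} {L = words n n} y∈))

module MobiusOfW {m n tl} (tail : Tail m n tl) (Φ : List ℕ → ℤ)
  (Φ-blocks : ∀ S → length S ≡ m → Φ (blocks S 0 tl) ≡ sign S)
  (Φ-support : ∀ {y} → InW n y → Φ y ≢ 0ℤ → ∃ λ S → length S ≡ m × y ≡ blocks S 0 tl)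
  (e≡ : idPerm n ≡ blocks (unswapped m) 0 tl) where

  open Tail tail using (2m≤n)

  private
    e = idPerm n

    bp : List Bool → List ℕ
    bp S = blocks S 0 tl

    bp∈W : ∀ {S} → S ∈ subsets m → InW n (bp S)
    bp∈W {S} S∈ = InW-blocks tail S (∈-subsets⇒length S∈)

    e≤bp : ∀ S → length S ≡ m → bruhat n e (bp S) ≡ true
    e≤bp S refl = subst (λ x → bruhat n x (bp S) ≡ true) (sym e≡) (bruhat-unswapped-blocks n S tl)

    Φ≢0⇒e≤ : ∀ {y} → InW n y → Φ y ≢ 0ℤ → bruhat n e y ≡ true
    Φ≢0⇒e≤ y∈W Φy≢0 with Φ-support y∈W Φy≢0
    ... | S , |S|≡m , refl = e≤bp S |S|≡m

  Φ-diag : ∀ {y} → eqList e y ≡ true → Φ y ≡ 1ℤ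
  Φ-diag e=y = begin
    Φ _                               ≡⟨ cong Φ (sym (trans (sym e≡) (eqList-true⇒≡ e=y))) ⟩
    Φ (bp (unswapped m))              ≡⟨ Φ-blocks (unswapped m) (length-replicate m) ⟩
    signPow (countTrue (unswapped m)) ≡⟨ cong signPow (countTrue-unswapped m) ⟩
    1ℤ                                ∎
    where open ≡-Reasoning

  Φ-≰ : ∀ {y} → y ∈ Wlist n → eqList e y ≡ false → bruhat n e y ≡ false → Φ y ≡ 0ℤ
  Φ-≰ {y} y∈ _ e≰y with Φ y ℤₚ.≟ 0ℤ
  ... | yes Φy≡0 = Φy≡0
  ... | no  Φy≢0 with () ← trans (sym (Φ≢0⇒e≤ (Wlist⇒InW y∈) Φy≢0)) e≰y

  module _ {y} (y∈W : InW n y) (e≤y : bruhat n e y ≡ true) where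

    private
      swaps = swapPattern y 0 m

      e≤y′ : bruhat n (bp (unswapped m)) y ≡ true
      e≤y′ = subst (λ x → bruhat n x y ≡ true) e≡ e≤y

    interval-as-subsets : sumOver (interval (Wlist n) (bruhat n) eqList e y) Φ
                          ≡ sumOver (subsets m) (λ S → ind (S ⊆ᵇ swaps ∧ not (eqList (bp S) y)) (sign S))
    interval-as-subsets = begin
      sumOver (filterᵇ Q (Wlist n)) Φ                       ≡⟨ sumOver-filter Q (Wlist n) Φ ⟩
      sumOver (Wlist n) (λ z → ind (Q z) (Φ z))             ≡⟨ sumOver-filter (isW n) (words n n) _ ⟩
      sumOver (words n n) G                                 ≡⟨ sumOver-reindex eqList eqList-true⇒≡ (words n n) (subsets m) bp
                                                                 once-in-words once-in-image G support ⟩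
      sumOver (subsets m) (G ∘ bp)                          ≡⟨ sumOver-cong (subsets m) G-bp ⟩
      sumOver (subsets m) (λ S → ind (S ⊆ᵇ swaps ∧ not (eqList (bp S) y)) (sign S)) ∎
      where
      open ≡-Reasoning
      Q : List ℕ → Bool
      Q z = bruhat n e z ∧ bruhat n z y ∧ not (eqList z y)
      G : List ℕ → ℤ
      G z = ind (isW n z) (ind (Q z) (Φ z))
      once-in-words : ∀ {S} → S ∈ subsets m → ∀ v → sumOver (words n n) (λ z → ind (eqList (bp S) z) v) ≡ v
      once-in-words {S} S∈ v = sumOver-words-indicator n n (bp S) v (InW.length≡ (bp∈W S∈)) (InW.bounded (bp∈W S∈))
      once-in-image : ∀ {T} → T ∈ subsets m → ∀ v → sumOver (subsets m) (λ S → ind (eqList (bp S) (bp T)) v) ≡ v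
      once-in-image {T} T∈ v =
        trans (sumOver-cong (subsets m) (λ {S} S∈ → cong (λ b → ind b v) (eqList-blocks S T 0 tl (trans (∈-subsets⇒length {m} S∈) (sym |T|≡m)))))
              (subst (λ k → sumOver (subsets k) (λ S → ind (does (S ≟ᴮ T)) v) ≡ v) |T|≡m (sumOver-subsets-indicator T v))
        where
        |T|≡m : length T ≡ m
        |T|≡m = ∈-subsets⇒length T∈
      support : ∀ z → G z ≢ 0ℤ → ∃ λ T → T ∈ subsets m × z ≡ bp T
      support z Gz≢0 with isW n z in z∈W
      ... | false = ⊥-elim (Gz≢0 refl)
      ... | true with Φ-support (isW⇒InW z∈W) (λ Φz≡0 → Gz≢0 (trans (cong (ind (Q z)) Φz≡0) (ind-0 (Q z))))
      ...   | T , |T|≡m , z≡ = T , ∈-subsets⁺ |T|≡m , z≡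
      G-bp : ∀ {S} → S ∈ subsets m → G (bp S) ≡ ind (S ⊆ᵇ swaps ∧ not (eqList (bp S) y)) (sign S)
      G-bp {S} S∈ rewrite InW⇒isW (bp∈W S∈) | e≤bp S (∈-subsets⇒length {m} S∈)
                        | bruhat-blocks n S tl y (subst (λ k → 2 * k ≤ n) (sym (∈-subsets⇒length {m} S∈)) 2m≤n)
                        | ∈-subsets⇒length {m} S∈ | e≤y′ | Φ-blocks S (∈-subsets⇒length {m} S∈) = refl

    private
      y≢e : eqList e y ≡ false → y ≢ e
      y≢e e≠y = eqList-false⇒≢ e≠y ∘ sym

    proper-sum-at-block : ∀ {T} → length T ≡ m → y ≡ bp T → eqList e y ≡ false →
      sumOver (subsets m) (λ S → ind (S ⊆ᵇ swaps ∧ not (eqList (bp S) y)) (sign S)) ≡ -ℤ sign T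
    proper-sum-at-block {T} |T|≡m refl e≠y = begin
      sumOver (subsets m) (λ S → ind (S ⊆ᵇ swaps ∧ not (eqList (bp S) (bp T))) (sign S))
        ≡⟨ sumOver-cong (subsets m) (λ {S} S∈ → cong₂ (λ U b → ind (S ⊆ᵇ U ∧ not b) (sign S))
              (trans (cong (swapPattern (bp T) 0) (sym |T|≡m)) (swapPattern-blocks T tl))
              (eqList-blocks S T 0 tl (trans (∈-subsets⇒length {m} S∈) (sym |T|≡m)))) ⟩
      sumOver (subsets m) (λ S → ind (S ⊆ᵇ T ∧ not (does (S ≟ᴮ T))) (sign S))
        ≡⟨ subst (λ k → sumOver (subsets k) (λ S → ind (S ⊆ᵇ T ∧ not (does (S ≟ᴮ T))) (sign S)) ≡ ind (all not T) 1ℤ -ℤ sign T)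
                 |T|≡m (sumOver-proper-subsets-sign T) ⟩
      ind (all not T) 1ℤ -ℤ sign T
        ≡⟨ cong (_-ℤ sign T) T-swaps ⟩
      0ℤ -ℤ sign T
        ≡⟨ ℤₚ.+-identityˡ _ ⟩
      -ℤ sign T ∎
      where
      open ≡-Reasoning
      T-swaps : ind (all not T) 1ℤ ≡ 0ℤ
      T-swaps with all not T in none
      ... | false = refl
      ... | true  = ⊥-elim (y≢e e≠y (trans (cong bp (trans (all-not⇒unswapped T none) (cong unswapped |T|≡m))) (sym e≡)))

    sum-off-blocks : Φ y ≡ 0ℤ → eqList e y ≡ false →
      sumOver (subsets m) (λ S → ind (S ⊆ᵇ swaps ∧ not (eqList (bp S) y)) (sign S)) ≡ 0ℤ
    sum-off-blocks Φy≡0 e≠y = begin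
      sumOver (subsets m) (λ S → ind (S ⊆ᵇ swaps ∧ not (eqList (bp S) y)) (sign S))
        ≡⟨ sumOver-cong (subsets m) (λ {S} S∈ → cong (λ b → ind b (sign S)) (trans (cong (λ b → S ⊆ᵇ swaps ∧ not b) (bp≢y S∈)) (∧-identityʳ _))) ⟩
      sumOver (subsets m) (λ S → ind (S ⊆ᵇ swaps) (sign S))
        ≡⟨ subst (λ k → sumOver (subsets k) (λ S → ind (S ⊆ᵇ swaps) (sign S)) ≡ ind (all not swaps) 1ℤ)
                 (length-swapPattern y 0 m) (sumOver-subsets-sign swaps) ⟩
      ind (all not swaps) 1ℤ
        ≡⟨ some-swap ⟩
      0ℤ ∎
      where
      open ≡-Reasoning
      bp≢y : ∀ {S} → S ∈ subsets m → eqList (bp S) y ≡ false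
      bp≢y {S} S∈ with eqList (bp S) y in bp=y
      ... | false = refl
      ... | true  = ⊥-elim (signPow≢0 (countTrue S) (trans (sym (Φ-blocks S (∈-subsets⇒length S∈))) (trans (cong Φ (eqList-true⇒≡ bp=y)) Φy≡0)))
      some-swap : ind (all not swaps) 1ℤ ≡ 0ℤ
      some-swap with all not swaps in none
      ... | false = refl
      ... | true  = ⊥-elim (y≢e e≠y (trans (unswapped-below⇒identity tail y∈W e≤y′ none) (sym e≡)))

    interval-sum : eqList e y ≡ false → sumOver (interval (Wlist n) (bruhat n) eqList e y) Φ ≡ -ℤ Φ y
    interval-sum e≠y with Φ y ℤₚ.≟ 0ℤ
    ... | yes Φy≡0 = trans interval-as-subsets (trans (sum-off-blocks Φy≡0 e≠y) (cong -ℤ_ (sym Φy≡0)))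
    ... | no  Φy≢0 with Φ-support y∈W Φy≢0
    ...   | T , |T|≡m , y≡ =
      trans interval-as-subsets (trans (proper-sum-at-block {T} |T|≡m y≡ e≠y) (cong -ℤ_ (sym (trans (cong Φ y≡) (Φ-blocks T |T|≡m)))))

  μW≡Φ : ∀ {y} → isW n y ≡ true → μW n e y ≡ Φ y
  μW≡Φ y∈W = mobius≡ (Wlist n) (bruhat n) eqList (bruhat-refl n) (bruhat-trans n)
                     (λ z∈ y∈ → bruhat-antisym n (Wlist⇒InW z∈) (Wlist⇒InW y∈)) eqList-refl
                     e Φ Φ-diag Φ-≰ (λ y∈ e≠y e≤y → interval-sum (Wlist⇒InW y∈) e≤y e≠y) (∈-Wlist y∈W)

proposition3p15 : (m : ℕ) → 0 < m →
    ((v : Data.List.List ℕ) → isW (2 * m + 1) v ≡ true →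
      μW (2 * m + 1) (idPerm (2 * m + 1)) v
        ≡ (if eqList (decτ m v) (idPerm m) ∧ (decJ m v ≡ᵇ (m + 1))
           then signPow (length (decTodd m v)) else 0ℤ))
    × ((v : Data.List.List ℕ) → isW (2 * m) v ≡ true →
      μW (2 * m) (idPerm (2 * m)) v
        ≡ (if eqList (decU m v) (idPerm m) then signPow (length (decT m v)) else 0ℤ))
proposition3p15 m _ = (λ _ → Odd.μW≡Φ) , (λ _ → Even.μW≡Φ)
  where
  -- The argument covers m = 0 as well.
  module Odd  = MobiusOfW (tail-odd m)  (formulaOdd m)  (formulaOdd-blocks m)  (formulaOdd-support m)  (identity-odd m)
  module Even = MobiusOfW (tail-even m) (formulaEven m) (formulaEven-blocks m) (formulaEven-support m) (identity-even m)
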